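{- For all integers $k\ge3$ and $\ell\ge2$, $\widetilde{r}(\sigma_{k,\ell}) \le k^2\ell+15k\ell+2k-12$.
   Context: For integers $k\ge3$ and $\ell\ge2$, the spider $\sigma_{k,\ell}$ is the tree formed as the union of $k$ paths, each of length $\ell$ (i.e. $\ell$ edges), that share exactly one common endpoint. The online Ramsey game for a target graph $H$ is played between Builder and Painter on an infinite set of vertices, initially with no edges. In each round Builder adds a new edge between two vertices (forming the background graph $G$), and Painter immediately colors that edge red or blue. The online Ramsey number $\widetilde{r}(H)$ is the minimum number $m$ such that Builder has a strategy guaranteeing that, against any Painter strategy, after at most $m$ rounds $G$ contains a monochromatic (not necessarily induced) subgraph isomorphic to $H$. -}

module Defs where

open import Data.Nat using (ℕ; suc; _≤_)
open import Data.Fin using (Fin; toℕ)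
open import Data.Maybe using (Maybe; just; nothing)
open import Data.Product using (Σ; ∃; _×_; _,_; proj₁)
open import Data.Sum using (_⊎_)
open import Data.List using (List; _∷_; [])
open import Data.List.Membership.Propositional using (_∈_)
open import Relation.Binary.PropositionalEquality using (_≡_; _≢_)
open import Relation.Nullary using (¬_)
open import Function.Definitions using (Injective)

data Colour : Set where
  red blue : Colour

Vertex : Set
Vertex = ℕ

-- A move of the game: Builder's edge {u,v} together with Painter's colour.
Move : Set
Move = Vertex × Vertex × Colour

-- History of the game (most recent move first).
History : Set
History = List Move

EdgeIn : History → Vertex → Vertex → Colour → Set
EdgeIn h u v c = ((u , v , c) ∈ h) ⊎ ((v , u , c) ∈ h)

ValidEdge : History → Vertex × Vertex → Set
ValidEdge h (u , v) = (u ≢ v) × ¬ (∃ λ c → EdgeIn h u v c)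

BuilderStrategy : Set
BuilderStrategy = (h : History) → Σ (Vertex × Vertex) (ValidEdge h)

PainterStrategy : Set
PainterStrategy = History → Vertex × Vertex → Colour

play : BuilderStrategy → PainterStrategy → ℕ → History
play B P 0 = []
play B P (suc n) with play B P n
... | h with proj₁ (B h)
...   | (u , v) = (u , v , P h (u , v)) ∷ h

record Graph : Set₁ where
  field
    V   : Set
    Adj : V → V → Set
open Graph public

MonoCopy : Graph → History → Set
MonoCopy H h =
  Σ Colour λ c → Σ (V H → Vertex) λ f →
    Injective _≡_ _≡_ f × (∀ x y → Adj H x y → EdgeIn h (f x) (f y) c)

OnlineRamseyAtMost : Graph → ℕ → Set
OnlineRamseyAtMost H m =
  Σ BuilderStrategy λ B → (P : PainterStrategy) →
    Σ ℕ λ t → t ≤ m × MonoCopy H (play B P t)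

-- The spider σ_{k,ℓ}: a centre (nothing) and k legs; just (a , p) is
-- the vertex at distance p+1 from the centre on leg a (p : Fin ℓ).

data SpiderAdj (k ℓ : ℕ) : Maybe (Fin k × Fin ℓ) → Maybe (Fin k × Fin ℓ) → Set where
  centre : ∀ a (p : Fin ℓ) → toℕ p ≡ 0 → SpiderAdj k ℓ nothing (just (a , p))
  step   : ∀ a (p q : Fin ℓ) → toℕ q ≡ suc (toℕ p) →
           SpiderAdj k ℓ (just (a , p)) (just (a , q))

spider : ℕ → ℕ → Graph
spider k ℓ = record { V = Maybe (Fin k × Fin ℓ) ; Adj = SpiderAdj k ℓ }

-- Builder first forces a long monochromatic path. She keeps a red and a
-- blue path leaving a common centre v, joins a fresh vertex F to v and then
-- to the far end z of the path whose colour differs from that of Fv;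
-- whatever Painter answers, the two paths again leave a common centre and
-- have one more edge between them. After 2N - 1 such steps, two rounds
-- each, one of the paths has N edges.
--
-- That path Q, of colour c, is cut into M = k + 1 + ⌊(kℓ - 1)/(2ℓ - 1)⌋
-- blocks of 2ℓ - 1 vertices. A fresh centre is joined to unused vertices of
-- distinct blocks. Once it has k edges of colour c, they extend along Q
-- inside their blocks to a c-spider, since every vertex of a block starts a
-- subpath of ℓ vertices within the block. Otherwise its first k edges of
-- the other colour d are the first level of a d-spider, and each d-vertex in
-- turn becomes a centre until it gets one d-edge, which lengthens its leg;
-- after kℓ d-edges the d-spider is complete. A centre avoids its own block
-- and the blocks it already hit in c, fewer than k in all, and fewer than kℓ
-- vertices are used, filling at most ⌊(kℓ - 1)/(2ℓ - 1)⌋ blocks: so a free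
-- block always exists. The rounds add up to 4M(2ℓ - 1) - 6 + (2k - 1) +
-- k(kℓ - k).

module Submission where

open import Defs
open import Data.Nat using (ℕ; zero; suc; NonZero; _+_; _*_; _∸_; _≤_; _<_; z≤n; s≤s; _≟_; _≤?_; _<?_; _⊔_; _/_; _%_)
open import Data.Nat.DivMod using (m≡m%n+[m/n]*n; m%n<n; m/n*n≤m)
open import Data.Nat.Properties
open import Data.Nat.Solver using (module +-*-Solver)
open import Data.Product using (Σ; ∃; _×_; _,_; proj₁; proj₂)
open import Data.Product.Properties using (≡-dec)
open import Data.Sum using (_⊎_; inj₁; inj₂)
open import Data.List using (List; []; _∷_; _++_; _∷ʳ_; _ʳ++_; reverse; length; map)
open import Data.List.Properties using (length-map; length-++; length-reverse; ++-identityʳ)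
open import Data.List.Membership.Propositional using (_∈_)
open import Data.List.Relation.Binary.Subset.Propositional using (_⊆_)
open import Data.List.Relation.Unary.Any using (here; there)
open import Data.Empty using (⊥; ⊥-elim)
open import Data.Unit using (⊤; tt)
open import Data.Maybe using (Maybe; just; nothing)
open import Data.Fin using (Fin; toℕ)
open import Data.Fin.Properties using (toℕ-injective; toℕ<n)
open import Relation.Binary.PropositionalEquality
open import Relation.Binary.Definitions using (DecidableEquality)
open import Relation.Nullary using (¬_; Dec; yes; no)
open import Function.Definitions using (Injective)

open +-*-Solver using (solve; _:+_; _:*_; _:=_; con)

_≟ᶜ_ : DecidableEquality Colour
red  ≟ᶜ red  = yes refl
red  ≟ᶜ blue = no (λ ())
blue ≟ᶜ red  = no (λ ())
blue ≟ᶜ blue = yes refl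

_≟ᵐ_ : DecidableEquality Move
_≟ᵐ_ = ≡-dec _≟_ (≡-dec _≟_ _≟ᶜ_)

open import Data.List.Membership.DecPropositional _≟ᵐ_ using (_∈?_)

-- A Builder program is a decision tree: ask for the colour of an edge and
-- branch on Painter's answer.
data Prog (A : Set) : Set where
  ret : A → Prog A
  ask : Vertex → Vertex → (Colour → Prog A) → Prog A

_>>=_ : ∀ {A B : Set} → Prog A → (A → Prog B) → Prog B
ret a     >>= g = g a
ask u v f >>= g = ask u v (λ c → f c >>= g)

Forces : ∀ {A : Set} → Prog A → ℕ → History → (History → A → Set) → Set
Forces (ret a)     n       K Q = Q K a
Forces (ask u v f) zero    K Q = ⊥
Forces (ask u v f) (suc n) K Q = (u ≢ v) × ((c : Colour) → Forces (f c) n ((u , v , c) ∷ K) Q)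

Forces-≤ : ∀ {A : Set} (p : Prog A) {n n′ K Q} → n ≤ n′ → Forces p n K Q → Forces p n′ K Q
Forces-≤ (ret a)     le       w        = w
Forces-≤ (ask u v f) {zero}   le       ()
Forces-≤ (ask u v f) {suc n} (s≤s le) (u≢v , w) = u≢v , λ c → Forces-≤ (f c) le (w c)

Forces-map : ∀ {A : Set} (p : Prog A) {n K} {Q R : History → A → Set} →
  (∀ K′ a → Q K′ a → R K′ a) → Forces p n K Q → Forces p n K R
Forces-map (ret a)     Q⇒R w = Q⇒R _ a w
Forces-map (ask u v f) {zero}  Q⇒R ()
Forces-map (ask u v f) {suc n} Q⇒R (u≢v , w) = u≢v , λ c → Forces-map (f c) Q⇒R (w c)

Forces->>= : ∀ {A B : Set} (p : Prog A) {g : A → Prog B} {n m K R} →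
  Forces p n K (λ K′ a → Forces (g a) m K′ R) → Forces (p >>= g) (n + m) K R
Forces->>= (ret a)     {g} {n} {m} w = Forces-≤ (g a) (m≤n+m m n) w
Forces->>= (ask u v f) {n = zero}  ()
Forces->>= (ask u v f) {n = suc n} (u≢v , w) = u≢v , λ c → Forces->>= (f c) (w c)

maxVertex : History → Vertex
maxVertex []                = 0
maxVertex ((u , v , _) ∷ h) = u ⊔ v ⊔ maxVertex h

∈⇒≤maxVertex : ∀ {h u v c} → (u , v , c) ∈ h → u ≤ maxVertex h × v ≤ maxVertex h
∈⇒≤maxVertex {(u , v , c) ∷ h} (here refl) =
  ≤-trans (m≤m⊔n u v) (m≤m⊔n (u ⊔ v) (maxVertex h)) ,
  ≤-trans (m≤n⊔m u v) (m≤m⊔n (u ⊔ v) (maxVertex h))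
∈⇒≤maxVertex {(a , b , c) ∷ h} (there m) with ∈⇒≤maxVertex {h} m
... | u≤ , v≤ = ≤-trans u≤ (m≤n⊔m (a ⊔ b) (maxVertex h)) , ≤-trans v≤ (m≤n⊔m (a ⊔ b) (maxVertex h))

Unknown : History → Vertex → Vertex → Set
Unknown h u v = ¬ (∃ λ c → EdgeIn h u v c)

-- The move Builder makes when her program has nothing left to ask.
freshEdge : (h : History) → Σ (Vertex × Vertex) (ValidEdge h)
freshEdge h = (suc (maxVertex h) , suc (suc (maxVertex h))) ,
              (λ e → 1+n≢n (sym (suc-injective e))) , unknown
  where
  unknown : Unknown h (suc (maxVertex h)) (suc (suc (maxVertex h)))
  unknown (c , inj₁ m) = 1+n≰n (proj₁ (∈⇒≤maxVertex m))
  unknown (c , inj₂ m) = 1+n≰n (proj₂ (∈⇒≤maxVertex m))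

data Known (h : History) (u v : Vertex) : Set where
  coloured : (c : Colour) → EdgeIn h u v c → Known h u v
  unknown  : Unknown h u v → Known h u v

known? : ∀ h u v → Known h u v
known? h u v with (u , v , red) ∈? h | (v , u , red) ∈? h | (u , v , blue) ∈? h | (v , u , blue) ∈? h
... | yes p | _     | _     | _     = coloured red (inj₁ p)
... | no _  | yes p | _     | _     = coloured red (inj₂ p)
... | no _  | no _  | yes p | _     = coloured blue (inj₁ p)
... | no _  | no _  | no _  | yes p = coloured blue (inj₂ p)
... | no a  | no b  | no c  | no d  = unknown absent
  where
  absent : Unknown h u v
  absent (red  , inj₁ x) = a x
  absent (red  , inj₂ x) = b x
  absent (blue , inj₁ x) = c x
  absent (blue , inj₂ x) = d x

skipKnown : Prog ⊤ → History → Prog ⊤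
skipKnown (ret a)     h = ret a
skipKnown (ask u v f) h with known? h u v
... | coloured c _ = skipKnown (f c) h
... | unknown _    = ask u v f

nextEdge : Prog ⊤ → (h : History) → Σ (Vertex × Vertex) (ValidEdge h)
nextEdge (ret _)     h = freshEdge h
nextEdge (ask u v f) h with u ≟ v | known? h u v
... | yes _   | _            = freshEdge h
... | no _    | coloured _ _ = freshEdge h
... | no u≢v  | unknown ¬uv  = (u , v) , u≢v , ¬uv

programStrategy : Prog ⊤ → BuilderStrategy
programStrategy T h = nextEdge (skipKnown T h) h

Consistent : History → Set
Consistent h = ∀ {u v c c′} → EdgeIn h u v c → EdgeIn h u v c′ → c ≡ c′

skipKnown-coloured : ∀ {h u v c} (f : Colour → Prog ⊤) → Consistent h → EdgeIn h u v c →
  skipKnown (ask u v f) h ≡ skipKnown (f c) h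
skipKnown-coloured {h} {u} {v} {c} f cons e with known? h u v
... | coloured c′ e′ rewrite cons e′ e = refl
... | unknown ¬uv = ⊥-elim (¬uv (c , e))

skipKnown-unknown : ∀ {h u v} (f : Colour → Prog ⊤) → Unknown h u v →
  skipKnown (ask u v f) h ≡ ask u v f
skipKnown-unknown {h} {u} {v} f ¬uv with known? h u v
... | coloured c e = ⊥-elim (¬uv (c , e))
... | unknown _    = refl

nextEdge-ask : ∀ {h u v} (f : Colour → Prog ⊤) → u ≢ v → Unknown h u v →
  proj₁ (nextEdge (ask u v f) h) ≡ (u , v)
nextEdge-ask {h} {u} {v} f u≢v ¬uv with u ≟ v | known? h u v
... | yes e | _            = ⊥-elim (u≢v e)
... | no _  | coloured c e = ⊥-elim (¬uv (c , e))
... | no _  | unknown _    = refl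

play-suc : ∀ B P n → play B P (suc n) ≡
  (proj₁ (proj₁ (B (play B P n))) , proj₂ (proj₁ (B (play B P n))) ,
   P (play B P n) (proj₁ (B (play B P n)))) ∷ play B P n
play-suc B P n with play B P n
... | h with proj₁ (B h)
...   | (u , v) = refl

EdgeIn-sym : ∀ {h u v c} → EdgeIn h u v c → EdgeIn h v u c
EdgeIn-sym (inj₁ x) = inj₂ x
EdgeIn-sym (inj₂ x) = inj₁ x

EdgeIn-∷ : ∀ {h u v c x y c′} → EdgeIn ((u , v , c) ∷ h) x y c′ →
  (((x ≡ u × y ≡ v) ⊎ (x ≡ v × y ≡ u)) × c′ ≡ c) ⊎ EdgeIn h x y c′
EdgeIn-∷ (inj₁ (here refl)) = inj₁ (inj₁ (refl , refl) , refl)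
EdgeIn-∷ (inj₁ (there m))   = inj₂ (inj₁ m)
EdgeIn-∷ (inj₂ (here refl)) = inj₁ (inj₂ (refl , refl) , refl)
EdgeIn-∷ (inj₂ (there m))   = inj₂ (inj₂ m)

Consistent-∷ : ∀ {h u v c} → Consistent h → Unknown h u v → Consistent ((u , v , c) ∷ h)
Consistent-∷ cons ¬uv e₁ e₂ with EdgeIn-∷ e₁ | EdgeIn-∷ e₂
... | inj₁ (_ , p) | inj₁ (_ , q) = trans p (sym q)
... | inj₁ (inj₁ (refl , refl) , _) | inj₂ e = ⊥-elim (¬uv (_ , e))
... | inj₁ (inj₂ (refl , refl) , _) | inj₂ e = ⊥-elim (¬uv (_ , EdgeIn-sym e))
... | inj₂ e | inj₁ (inj₁ (refl , refl) , _) = ⊥-elim (¬uv (_ , e))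
... | inj₂ e | inj₁ (inj₂ (refl , refl) , _) = ⊥-elim (¬uv (_ , EdgeIn-sym e))
... | inj₂ e | inj₂ e′ = cons e e′

play-consistent : ∀ B P n → Consistent (play B P n)
play-consistent B P zero    (inj₁ ()) _
play-consistent B P zero    (inj₂ ()) _
play-consistent B P (suc n) rewrite play-suc B P n =
  Consistent-∷ (play-consistent B P n) (proj₂ (proj₂ (B (play B P n))))

CopyOf : Graph → History → ⊤ → Set
CopyOf H K _ = MonoCopy H K

_⊑_ : History → History → Set
K ⊑ h = ∀ {u v c} → (u , v , c) ∈ K → EdgeIn h u v c

EdgeIn-⊑ : ∀ {K h u v c} → K ⊑ h → EdgeIn K u v c → EdgeIn h u v c
EdgeIn-⊑ K⊑h (inj₁ m) = K⊑h m
EdgeIn-⊑ K⊑h (inj₂ m) = EdgeIn-sym (K⊑h m)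

MonoCopy-⊑ : ∀ {H K h} → K ⊑ h → MonoCopy H K → MonoCopy H h
MonoCopy-⊑ K⊑h (c , f , f-inj , edges) = c , f , f-inj , λ x y a → EdgeIn-⊑ K⊑h (edges x y a)

data Reachable (T₀ : Prog ⊤) : Prog ⊤ → History → Set where
  root : Reachable T₀ T₀ []
  step : ∀ {u v f K} → Reachable T₀ (ask u v f) K → ∀ c → Reachable T₀ (f c) ((u , v , c) ∷ K)

skipKnown-reachable : ∀ {T₀ T K h} → Reachable T₀ T K → Consistent h → K ⊑ h →
  skipKnown T₀ h ≡ skipKnown T h
skipKnown-reachable root               cons K⊑h = refl
skipKnown-reachable (step {f = f} r c) cons K⊑h =
  trans (skipKnown-reachable r cons (λ m → K⊑h (there m))) (skipKnown-coloured f cons (K⊑h (here refl)))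

module _ (H : Graph) (T₀ : Prog ⊤) (P : PainterStrategy) where
  private
    B : BuilderStrategy
    B = programStrategy T₀

  programStrategy-wins : ∀ (T : Prog ⊤) d K → Forces T d K (CopyOf H) →
    Reachable T₀ T K → ∀ t → K ⊑ play B P t →
    Σ ℕ λ t′ → t′ ≤ t + d × MonoCopy H (play B P t′)
  programStrategy-wins (ret a) d K w r t K⊑ = t , m≤m+n t d , MonoCopy-⊑ K⊑ w
  programStrategy-wins (ask u v f) zero K () r t K⊑
  programStrategy-wins (ask u v f) (suc d) K (u≢v , w) r t K⊑ with known? (play B P t) u v
  ... | coloured c e with programStrategy-wins (f c) d _ (w c) (step r c) t K⊑′
    where
    K⊑′ : ((u , v , c) ∷ K) ⊑ play B P t
    K⊑′ (here refl) = e
    K⊑′ (there m)   = K⊑ m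
  ... | t′ , le , copy = t′ , ≤-trans le (+-monoʳ-≤ t (n≤1+n d)) , copy
  programStrategy-wins (ask u v f) (suc d) K (u≢v , w) r t K⊑ | unknown ¬uv
    with programStrategy-wins (f (P (play B P t) (u , v))) d _ (w _) (step r _) (suc t) K⊑′
    where
    h = play B P t
    builder-asks : proj₁ (B h) ≡ (u , v)
    builder-asks = trans (cong (λ T → proj₁ (nextEdge T h))
                           (trans (skipKnown-reachable r (play-consistent B P t) K⊑) (skipKnown-unknown f ¬uv)))
                         (nextEdge-ask f u≢v ¬uv)
    play-next : play B P (suc t) ≡ (u , v , P h (u , v)) ∷ h
    play-next = trans (play-suc B P t) (cong (λ e → (proj₁ e , proj₂ e , P h e) ∷ h) builder-asks)
    K⊑′ : ((u , v , P h (u , v)) ∷ K) ⊑ play B P (suc t)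
    K⊑′ (here refl) rewrite play-next = inj₁ (here refl)
    K⊑′ (there m)   rewrite play-next with K⊑ m
    ... | inj₁ x = inj₁ (there x)
    ... | inj₂ x = inj₂ (there x)
  ... | t′ , le , copy = t′ , ≤-trans le (≤-reflexive (sym (+-suc t d))) , copy

Forces⇒OnlineRamseyAtMost : ∀ {H m} (T : Prog ⊤) → Forces T m [] (CopyOf H) →
  OnlineRamseyAtMost H m
Forces⇒OnlineRamseyAtMost {H} {m} T w =
  programStrategy T , λ P → programStrategy-wins H T P T m [] w root 0 (λ ())

-- Lookup with a default, so that indices need not carry bounds.
nth : ∀ {A : Set} → A → List A → ℕ → A
nth d []       i       = d
nth d (x ∷ xs) zero    = x
nth d (x ∷ xs) (suc i) = nth d xs i

nth-++ˡ : ∀ {A : Set} (d : A) xs ys i → i < length xs → nth d (xs ++ ys) i ≡ nth d xs i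
nth-++ˡ d (x ∷ xs) ys zero    _        = refl
nth-++ˡ d (x ∷ xs) ys (suc i) (s≤s lt) = nth-++ˡ d xs ys i lt

nth-∷ʳ : ∀ {A : Set} (d : A) xs y → nth d (xs ∷ʳ y) (length xs) ≡ y
nth-∷ʳ d []       y = refl
nth-∷ʳ d (x ∷ xs) y = nth-∷ʳ d xs y

nth-map : ∀ {A B : Set} (f : A → B) (d : A) xs i → nth (f d) (map f xs) i ≡ f (nth d xs i)
nth-map f d []       i       = refl
nth-map f d (x ∷ xs) zero    = refl
nth-map f d (x ∷ xs) (suc i) = nth-map f d xs i

module Count {A : Set} (_≟ᵃ_ : DecidableEquality A) where
  count : A → List A → ℕ
  count x [] = 0
  count x (y ∷ ys) with x ≟ᵃ y
  ... | yes _ = suc (count x ys)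
  ... | no _  = count x ys

  count-++ : ∀ x xs ys → count x (xs ++ ys) ≡ count x xs + count x ys
  count-++ x []       ys = refl
  count-++ x (y ∷ xs) ys with x ≟ᵃ y
  ... | yes _ = cong suc (count-++ x xs ys)
  ... | no _  = count-++ x xs ys

  count-∷ : ∀ x y ys → count x (y ∷ ys) ≡ count x (y ∷ []) + count x ys
  count-∷ x y ys = count-++ x (y ∷ []) ys

  count-self : ∀ x → count x (x ∷ []) ≡ 1
  count-self x with x ≟ᵃ x
  ... | yes _   = refl
  ... | no x≢x = ⊥-elim (x≢x refl)

  count-≢ : ∀ x y → x ≢ y → count x (y ∷ []) ≡ 0
  count-≢ x y x≢y with x ≟ᵃ y
  ... | yes e = ⊥-elim (x≢y e)
  ... | no _  = refl

  count-singleton≤1 : ∀ x y → count x (y ∷ []) ≤ 1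
  count-singleton≤1 x y with x ≟ᵃ y
  ... | yes _ = s≤s z≤n
  ... | no _  = z≤n

  count-singleton-pos : ∀ x y → 1 ≤ count x (y ∷ []) → x ≡ y
  count-singleton-pos x y le with x ≟ᵃ y
  ... | yes e = e
  count-singleton-pos x y () | no _

  count-head : ∀ x xs → count x (x ∷ xs) ≡ suc (count x xs)
  count-head x xs = trans (count-∷ x x xs) (cong (_+ count x xs) (count-self x))

  count-ʳ++ : ∀ x xs ys → count x (xs ʳ++ ys) ≡ count x xs + count x ys
  count-ʳ++ x []       ys = refl
  count-ʳ++ x (y ∷ xs) ys = begin
    count x (xs ʳ++ y ∷ ys)                           ≡⟨ count-ʳ++ x xs (y ∷ ys) ⟩
    count x xs + count x (y ∷ ys)                     ≡⟨ cong (count x xs +_) (count-∷ x y ys) ⟩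
    count x xs + (count x (y ∷ []) + count x ys)      ≡⟨ solve 3 (λ a b c → a :+ (b :+ c) := (b :+ a) :+ c) refl
                                                          (count x xs) (count x (y ∷ [])) (count x ys) ⟩
    (count x (y ∷ []) + count x xs) + count x ys      ≡⟨ cong (_+ count x ys) (sym (count-∷ x y xs)) ⟩
    count x (y ∷ xs) + count x ys                     ∎
    where open ≡-Reasoning

  count-reverse : ∀ x xs → count x (reverse xs) ≡ count x xs
  count-reverse x xs = trans (count-ʳ++ x xs []) (+-identityʳ _)

  Distinct : List A → Set
  Distinct xs = ∀ x → count x xs ≤ 1

  Distinct-∷⇒∉ : ∀ x xs → Distinct (x ∷ xs) → 1 ≤ count x xs → ⊥
  Distinct-∷⇒∉ x xs dis le =
    1+n≰n (≤-trans (s≤s le) (≤-trans (≤-reflexive (sym (count-head x xs))) (dis x)))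

  Distinct-tail : ∀ x xs → Distinct (x ∷ xs) → Distinct xs
  Distinct-tail x xs dis y =
    ≤-trans (m≤n+m (count y xs) (count y (x ∷ []))) (≤-trans (≤-reflexive (sym (count-∷ y x xs))) (dis y))

  Distinct-++ʳ : ∀ xs ys → Distinct (xs ++ ys) → Distinct ys
  Distinct-++ʳ xs ys dis x =
    ≤-trans (m≤n+m (count x ys) (count x xs)) (≤-trans (≤-reflexive (sym (count-++ x xs ys))) (dis x))

  Distinct-++⇒∉ : ∀ xs ys x → Distinct (xs ++ ys) → 1 ≤ count x ys → count x xs ≡ 0
  Distinct-++⇒∉ xs ys x dis le with count x xs in e
  ... | zero  = refl
  ... | suc m = ⊥-elim (1+n≰n (≤-trans (+-mono-≤ (s≤s (z≤n {m})) le)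
          (≤-trans (≤-reflexive (cong (_+ count x ys) (sym e)))
            (≤-trans (≤-reflexive (sym (count-++ x xs ys))) (dis x)))))

  Distinct-insert : ∀ xs ys y → Distinct (xs ++ ys) → count y (xs ++ ys) ≡ 0 → Distinct (xs ++ y ∷ ys)
  Distinct-insert xs ys y dis y∉ x with x ≟ᵃ y
  ... | yes refl rewrite count-++ x xs (x ∷ ys) | count-head x ys
                       | +-suc (count x xs) (count x ys) | sym (count-++ x xs ys) | y∉ = ≤-refl
  ... | no x≢y rewrite count-++ x xs (y ∷ ys) | count-∷ x y ys | count-≢ x y x≢y
                     | sym (count-++ x xs ys) = dis x

  count-∷ʳ-≢ : ∀ x xs y → x ≢ y → count x (xs ∷ʳ y) ≡ count x xs
  count-∷ʳ-≢ x xs y x≢y =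
    trans (count-++ x xs (y ∷ [])) (trans (cong (count x xs +_) (count-≢ x y x≢y)) (+-identityʳ _))

  Distinct-∷ʳ : ∀ xs y → Distinct xs → count y xs ≡ 0 → Distinct (xs ∷ʳ y)
  Distinct-∷ʳ xs y dis y∉ = Distinct-insert xs [] y (subst Distinct (sym (++-identityʳ xs)) dis)
                              (trans (cong (count y) (++-identityʳ xs)) y∉)

  nth-∈ : ∀ d xs i → i < length xs → 1 ≤ count (nth d xs i) xs
  nth-∈ d (x ∷ xs) zero    _ rewrite count-head x xs = s≤s z≤n
  nth-∈ d (x ∷ xs) (suc i) (s≤s lt) rewrite count-∷ (nth d xs i) x xs =
    ≤-trans (nth-∈ d xs i lt) (m≤n+m _ _)

  nth-injective : ∀ d xs → Distinct xs → ∀ i j → i < length xs → j < length xs →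
    nth d xs i ≡ nth d xs j → i ≡ j
  nth-injective d (x ∷ xs) dis zero    zero    _ _ e = refl
  nth-injective d (x ∷ xs) dis zero    (suc j) _ (s≤s lj) e =
    ⊥-elim (Distinct-∷⇒∉ x xs dis (subst (λ y → 1 ≤ count y xs) (sym e) (nth-∈ d xs j lj)))
  nth-injective d (x ∷ xs) dis (suc i) zero    (s≤s li) _ e =
    ⊥-elim (Distinct-∷⇒∉ x xs dis (subst (λ y → 1 ≤ count y xs) e (nth-∈ d xs i li)))
  nth-injective d (x ∷ xs) dis (suc i) (suc j) (s≤s li) (s≤s lj) e =
    cong suc (nth-injective d xs (Distinct-tail x xs dis) i j li lj e)


open Count _≟_ public
module Countᵖ = Count (≡-dec _≟_ _≟_)

Path : History → Colour → List Vertex → Set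
Path K c []           = ⊤
Path K c (x ∷ [])     = ⊤
Path K c (x ∷ y ∷ ys) = EdgeIn K x y c × Path K c (y ∷ ys)

EdgeIn-⊆ : ∀ {K K′ u v c} → K ⊆ K′ → EdgeIn K u v c → EdgeIn K′ u v c
EdgeIn-⊆ K⊆K′ (inj₁ m) = inj₁ (K⊆K′ m)
EdgeIn-⊆ K⊆K′ (inj₂ m) = inj₂ (K⊆K′ m)

Path-⊆ : ∀ {K K′ c} xs → K ⊆ K′ → Path K c xs → Path K′ c xs
Path-⊆ []           K⊆K′ p       = tt
Path-⊆ (x ∷ [])     K⊆K′ p       = tt
Path-⊆ (x ∷ y ∷ ys) K⊆K′ (e , p) = EdgeIn-⊆ K⊆K′ e , Path-⊆ (y ∷ ys) K⊆K′ p

Path-tail : ∀ {K c} x xs → Path K c (x ∷ xs) → Path K c xs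
Path-tail x []       p       = tt
Path-tail x (y ∷ ys) (e , p) = p

Path-ʳ++ : ∀ {K c} x xs ys → Path K c (x ∷ xs) → Path K c (x ∷ ys) → Path K c (xs ʳ++ x ∷ ys)
Path-ʳ++ x []       ys p       q = q
Path-ʳ++ x (y ∷ xs) ys (e , p) q = Path-ʳ++ y xs (x ∷ ys) p (EdgeIn-sym e , q)

Path-reverse : ∀ {K c} xs → Path K c xs → Path K c (reverse xs)
Path-reverse []       p = tt
Path-reverse (x ∷ xs) p = Path-ʳ++ x xs [] p tt

Path-nth : ∀ {K c} xs i → Path K c xs → suc i < length xs →
  EdgeIn K (nth 0 xs i) (nth 0 xs (suc i)) c
Path-nth (x ∷ [])     zero    p       (s≤s ())
Path-nth (x ∷ [])     (suc i) p       (s≤s ())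
Path-nth (x ∷ y ∷ ys) zero    (e , p) lt       = e
Path-nth (x ∷ y ∷ ys) (suc i) (e , p) (s≤s lt) = Path-nth (y ∷ ys) i p lt

other : Colour → Colour
other red  = blue
other blue = red

≢⇒other : ∀ a b → b ≢ a → b ≡ other a
≢⇒other red  red  b≢a = ⊥-elim (b≢a refl)
≢⇒other red  blue b≢a = refl
≢⇒other blue red  b≢a = refl
≢⇒other blue blue b≢a = ⊥-elim (b≢a refl)

-- The red and the blue path leaving a common centre, centre omitted.
PathPair : Set
PathPair = List Vertex × List Vertex

pathOf : Colour → PathPair → List Vertex
pathOf red  P = proj₁ P
pathOf blue P = proj₂ P

withPaths : Colour → List Vertex → List Vertex → PathPair
withPaths red  X Y = X , Y
withPaths blue X Y = Y , X

size : PathPair → ℕ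
size P = length (proj₁ P) + length (proj₂ P)

multiplicity : Vertex → PathPair → Vertex → ℕ
multiplicity v P x = count x (v ∷ []) + (count x (proj₁ P) + count x (proj₂ P))

count-pathOf : ∀ a P x → count x (proj₁ P) + count x (proj₂ P) ≡ count x (pathOf a P) + count x (pathOf (other a) P)
count-pathOf red  P x = refl
count-pathOf blue P x = +-comm (count x (proj₁ P)) (count x (proj₂ P))

count-withPaths : ∀ a X Y x → count x (proj₁ (withPaths a X Y)) + count x (proj₂ (withPaths a X Y)) ≡ count x X + count x Y
count-withPaths red  X Y x = refl
count-withPaths blue X Y x = +-comm (count x Y) (count x X)

size-pathOf : ∀ a P → size P ≡ length (pathOf a P) + length (pathOf (other a) P)
size-pathOf red  P = refl
size-pathOf blue P = +-comm (length (proj₁ P)) (length (proj₂ P))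

size-withPaths : ∀ a X Y → size (withPaths a X Y) ≡ length X + length Y
size-withPaths red  X Y = refl
size-withPaths blue X Y = +-comm (length Y) (length X)

Path-withPaths : ∀ K a v X Y → Path K a (v ∷ X) → Path K (other a) (v ∷ Y) →
  ∀ b → Path K b (v ∷ pathOf b (withPaths a X Y))
Path-withPaths K red  v X Y p q red  = p
Path-withPaths K red  v X Y p q blue = q
Path-withPaths K blue v X Y p q red  = q
Path-withPaths K blue v X Y p q blue = p

-- The next fresh vertex, the centre and the two paths.
VConfig : Set
VConfig = ℕ × Vertex × PathPair

ValidV : History → VConfig → Set
ValidV K (F , v , P) = (∀ x → multiplicity v P x ≤ 1) × (∀ x → 1 ≤ multiplicity v P x → x < F) ×
  ((a : Colour) → Path K a (v ∷ pathOf a P))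

sizeV : VConfig → ℕ
sizeV (F , v , P) = size P

-- F was joined to the centre v in colour a and then to the far end z of
-- the path of the other colour, in colour b.
growClose : ℕ → Vertex → PathPair → Colour → Vertex → List Vertex → Colour → Prog VConfig
growClose F v P a z zs b with b ≟ᶜ a
... | yes _ = ret (suc F , z , withPaths a (F ∷ v ∷ pathOf a P) zs)
... | no _  = ret (suc F , F , withPaths a (v ∷ pathOf a P) (z ∷ zs))

growFar : ℕ → Vertex → PathPair → Colour → List Vertex → Prog VConfig
growFar F v P a []       = ret (suc F , F , withPaths a (v ∷ pathOf a P) [])
growFar F v P a (z ∷ zs) = ask F z (growClose F v P a z zs)

grow : VConfig → Prog VConfig
grow (F , v , P) = ask F v (λ a → growFar F v P a (reverse (pathOf (other a) P)))

growTimes : ℕ → VConfig → Prog VConfig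
growTimes zero    V = ret V
growTimes (suc n) V = grow V >>= growTimes n

add-fresh : ∀ (F : ℕ) (old new : Vertex → ℕ) → (∀ x → new x ≡ count x (F ∷ []) + old x) →
  (∀ x → old x ≤ 1) → (∀ x → 1 ≤ old x → x < F) →
  (∀ x → new x ≤ 1) × (∀ x → 1 ≤ new x → x < suc F)
add-fresh F old new new≡ old≤1 old<F = new≤1 , new<F
  where
  oldF : old F ≡ 0
  oldF with old F in e
  ... | zero  = refl
  ... | suc _ = ⊥-elim (1+n≰n (old<F F (≤-trans (s≤s z≤n) (≤-reflexive (sym e)))))
  new≤1 : ∀ x → new x ≤ 1
  new≤1 x with x ≟ F
  ... | yes refl rewrite new≡ F | count-self F | oldF = s≤s z≤n
  ... | no x≢F   rewrite new≡ x | count-≢ x F x≢F = old≤1 x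
  new<F : ∀ x → 1 ≤ new x → x < suc F
  new<F x le with x ≟ F
  ... | yes refl = ≤-refl
  ... | no x≢F rewrite new≡ x | count-≢ x F x≢F = ≤-trans (old<F x le) (n≤1+n F)

ValidV-⊆ : ∀ {K K′} V → K ⊆ K′ → ValidV K V → ValidV K′ V
ValidV-⊆ (F , v , P) K⊆K′ (mult≤1 , mult<F , paths) =
  mult≤1 , mult<F , λ a → Path-⊆ (v ∷ pathOf a P) K⊆K′ (paths a)

ValidV-fresh : ∀ {K₀ K F v P} w a X Y → ValidV K₀ (F , v , P) →
  (∀ x → multiplicity w (withPaths a X Y) x ≡ count x (F ∷ []) + multiplicity v P x) →
  Path K a (w ∷ X) → Path K (other a) (w ∷ Y) → ValidV K (suc F , w , withPaths a X Y)
ValidV-fresh {F = F} {v} {P} w a X Y (mult≤1 , mult<F , _) mult≡ p q =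
  proj₁ valid , proj₂ valid , Path-withPaths _ a w X Y p q
  where
  valid = add-fresh F (multiplicity v P) (multiplicity w (withPaths a X Y)) mult≡ mult≤1 mult<F

Grown : ℕ → History → VConfig → Set
Grown m K V = ValidV K V × sizeV V ≡ suc m

-- zs is the path of the other colour read from its far end z.
growClose-ok : ∀ K F v P a z zs → ValidV K (F , v , P) → EdgeIn K F v a →
  (∀ x → count x (z ∷ zs) ≡ count x (pathOf (other a) P)) → length (z ∷ zs) ≡ length (pathOf (other a) P) →
  Path K (other a) (z ∷ zs) →
  ∀ b → Forces (growClose F v P a z zs b) 0 ((F , z , b) ∷ K) (λ K′ V → Grown (size P) K′ V)
growClose-ok K F v P a z zs valid Fv count-zs length-zs path-zs b with b ≟ᶜ a
... | yes refl =
  ValidV-fresh z b (F ∷ v ∷ Pa) zs valid mult≡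
    (inj₂ (here refl) , EdgeIn-⊆ there Fv , Path-⊆ (v ∷ Pa) there (proj₂ (proj₂ valid) b))
    (Path-⊆ (z ∷ zs) there path-zs) ,
  grows
  where
  Pa = pathOf b P
  mult≡ : ∀ x → multiplicity z (withPaths b (F ∷ v ∷ Pa) zs) x ≡ count x (F ∷ []) + multiplicity v P x
  mult≡ x rewrite count-withPaths b (F ∷ v ∷ Pa) zs x | count-pathOf b P x | sym (count-zs x)
                | count-∷ x F (v ∷ Pa) | count-∷ x v Pa | count-∷ x z zs =
    solve 5 (λ cz cf cv ca cb → cz :+ ((cf :+ (cv :+ ca)) :+ cb) := cf :+ (cv :+ (ca :+ (cz :+ cb))))
      refl (count x (z ∷ [])) (count x (F ∷ [])) (count x (v ∷ [])) (count x Pa) (count x zs)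
  grows : size (withPaths b (F ∷ v ∷ Pa) zs) ≡ suc (size P)
  grows rewrite size-withPaths b (F ∷ v ∷ Pa) zs | size-pathOf b P | sym length-zs =
    cong suc (sym (+-suc (length Pa) (length zs)))
... | no b≢a with ≢⇒other a b b≢a
...   | refl =
  ValidV-fresh F a (v ∷ Pa) (z ∷ zs) valid mult≡
    (EdgeIn-⊆ there Fv , Path-⊆ (v ∷ Pa) there (proj₂ (proj₂ valid) a))
    (inj₁ (here refl) , Path-⊆ (z ∷ zs) there path-zs) ,
  grows
  where
  Pa = pathOf a P
  mult≡ : ∀ x → multiplicity F (withPaths a (v ∷ Pa) (z ∷ zs)) x ≡ count x (F ∷ []) + multiplicity v P x
  mult≡ x rewrite count-withPaths a (v ∷ Pa) (z ∷ zs) x | count-pathOf a P x | sym (count-zs x)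
                | count-∷ x v Pa =
    solve 4 (λ cf cv ca cb → cf :+ ((cv :+ ca) :+ cb) := cf :+ (cv :+ (ca :+ cb)))
      refl (count x (F ∷ [])) (count x (v ∷ [])) (count x Pa) (count x (z ∷ zs))
  grows : size (withPaths a (v ∷ Pa) (z ∷ zs)) ≡ suc (size P)
  grows rewrite size-withPaths a (v ∷ Pa) (z ∷ zs) | size-pathOf a P | sym length-zs = refl

growFar-ok : ∀ K F v P a ys → ValidV K (F , v , P) → EdgeIn K F v a →
  (∀ x → count x ys ≡ count x (pathOf (other a) P)) → length ys ≡ length (pathOf (other a) P) →
  Path K (other a) ys →
  Forces (growFar F v P a ys) 1 K (λ K′ V → Grown (size P) K′ V)
growFar-ok K F v P a [] valid Fv count-ys length-ys path-ys =
  ValidV-fresh F a (v ∷ Pa) [] valid mult≡ (Fv , proj₂ (proj₂ valid) a) tt , grows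
  where
  Pa = pathOf a P
  mult≡ : ∀ x → multiplicity F (withPaths a (v ∷ Pa) []) x ≡ count x (F ∷ []) + multiplicity v P x
  mult≡ x rewrite count-withPaths a (v ∷ Pa) [] x | count-pathOf a P x | sym (count-ys x) | count-∷ x v Pa =
    solve 3 (λ cf cv ca → cf :+ ((cv :+ ca) :+ con 0) := cf :+ (cv :+ (ca :+ con 0)))
      refl (count x (F ∷ [])) (count x (v ∷ [])) (count x Pa)
  grows : size (withPaths a (v ∷ Pa) []) ≡ suc (size P)
  grows rewrite size-withPaths a (v ∷ Pa) [] | size-pathOf a P | sym length-ys = refl
growFar-ok K F v P a (z ∷ zs) valid Fv count-ys length-ys path-ys =
  F≢z , growClose-ok K F v P a z zs valid Fv count-ys length-ys path-ys
  where
  z∈ : 1 ≤ multiplicity v P z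
  z∈ rewrite count-pathOf a P z | sym (count-ys z) | count-head z zs =
    ≤-trans (≤-trans (s≤s z≤n) (m≤n+m (suc (count z zs)) (count z (pathOf a P)))) (m≤n+m _ (count z (v ∷ [])))
  F≢z : F ≢ z
  F≢z refl = 1+n≰n (proj₁ (proj₂ valid) F z∈)

grow-ok : ∀ K V → ValidV K V → Forces (grow V) 2 K (λ K′ V′ → Grown (sizeV V) K′ V′)
grow-ok K (F , v , P) valid@(_ , mult<F , paths) = F≢v , λ a →
  growFar-ok ((F , v , a) ∷ K) F v P a (reverse (others a)) (ValidV-⊆ (F , v , P) there valid)
    (inj₁ (here refl)) (λ x → count-reverse x (others a)) (length-reverse (others a))
    (Path-⊆ (reverse (others a)) there (Path-reverse (others a) (Path-tail v (others a) (paths (other a)))))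
  where
  others : Colour → List Vertex
  others a = pathOf (other a) P
  v∈ : 1 ≤ multiplicity v P v
  v∈ rewrite count-self v = s≤s z≤n
  F≢v : F ≢ v
  F≢v refl = 1+n≰n (mult<F F v∈)

growTimes-ok : ∀ n K V → ValidV K V →
  Forces (growTimes n V) (2 * n) K (λ K′ V′ → ValidV K′ V′ × sizeV V′ ≡ n + sizeV V)
growTimes-ok zero    K V valid = valid , refl
growTimes-ok (suc n) K V valid =
  Forces-≤ (grow V >>= growTimes n) (≤-reflexive (sym (*-suc 2 n)))
    (Forces->>= (grow V) {g = growTimes n} {n = 2} {m = 2 * n}
      (Forces-map (grow V) {n = 2}
        (λ K′ V′ (valid′ , grown) → Forces-map (growTimes n V′) {n = 2 * n}
          (λ K″ V″ (valid″ , size≡) → valid″ , trans size≡ (trans (cong (n +_) grown) (+-suc n (sizeV V))))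
          (growTimes-ok n K′ V′ valid′))
        (grow-ok K V valid)))

length-∷ʳ : ∀ {A : Set} (xs : List A) x → length (xs ∷ʳ x) ≡ suc (length xs)
length-∷ʳ xs x = trans (length-++ xs) (+-comm (length xs) 1)

sumTo : (ℕ → ℕ) → ℕ → ℕ
sumTo f zero    = 0
sumTo f (suc n) = sumTo f n + f n

sumTo-zero : ∀ n → sumTo (λ _ → 0) n ≡ 0
sumTo-zero zero    = refl
sumTo-zero (suc n) = trans (+-identityʳ _) (sumTo-zero n)

bump : (ℕ → ℕ) → ℕ → ℕ → ℕ
bump f j j′ with j′ ≟ j
... | yes _ = suc (f j)
... | no _  = f j′

bump-≡ : ∀ f j → bump f j j ≡ suc (f j)
bump-≡ f j with j ≟ j
... | yes _   = refl
... | no j≢j = ⊥-elim (j≢j refl)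

bump-≥ : ∀ f j j′ → f j′ ≤ bump f j j′
bump-≥ f j j′ with j′ ≟ j
... | yes refl = n≤1+n _
... | no _     = ≤-refl

sumTo-bump-≤ : ∀ f j n → n ≤ j → sumTo (bump f j) n ≡ sumTo f n
sumTo-bump-≤ f j zero    le = refl
sumTo-bump-≤ f j (suc n) le with n ≟ j
... | yes refl = ⊥-elim (1+n≰n le)
... | no _     = cong (_+ f n) (sumTo-bump-≤ f j n (≤-trans (n≤1+n n) le))

sumTo-bump : ∀ f j n → j < n → sumTo (bump f j) n ≡ suc (sumTo f n)
sumTo-bump f j (suc n) lt with n ≟ j
... | yes refl = trans (cong (_+ suc (f n)) (sumTo-bump-≤ f n n ≤-refl)) (+-suc (sumTo f n) (f n))
... | no n≢j   = cong (_+ f n) (sumTo-bump f j n (≤∧≢⇒< (≤-pred lt) (λ e → n≢j (sym e))))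

indicator : ℕ → ℕ
indicator zero    = 0
indicator (suc _) = 1

indicator-+ : ∀ a b → indicator (a + b) ≤ indicator a + indicator b
indicator-+ zero    b = ≤-refl
indicator-+ (suc a) b = s≤s z≤n

occupied : List ℕ → ℕ → ℕ
occupied X zero    = 0
occupied X (suc n) = occupied X n + indicator (count n X)

occupied-singleton : ∀ x n → occupied (x ∷ []) n ≤ 1
occupied-singleton x n = proj₁ (go n)
  where
  go : ∀ n → occupied (x ∷ []) n ≤ 1 × (n ≤ x → occupied (x ∷ []) n ≡ 0)
  go zero    = z≤n , λ _ → refl
  go (suc n) = extend (go n) (n ≟ x)
    where
    extend : occupied (x ∷ []) n ≤ 1 × (n ≤ x → occupied (x ∷ []) n ≡ 0) → Dec (n ≡ x) →
      occupied (x ∷ []) (suc n) ≤ 1 × (suc n ≤ x → occupied (x ∷ []) (suc n) ≡ 0)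
    extend (_ , below) (yes refl) rewrite below ≤-refl | count-self n = ≤-refl , λ le → ⊥-elim (1+n≰n le)
    extend (≤1 , below) (no n≢x) rewrite count-≢ n x n≢x | +-identityʳ (occupied (x ∷ []) n) =
      ≤1 , λ le → below (≤-trans (n≤1+n n) le)

occupied-∷ : ∀ x X n → occupied (x ∷ X) n ≤ occupied (x ∷ []) n + occupied X n
occupied-∷ x X zero    = z≤n
occupied-∷ x X (suc n) = begin
    occupied (x ∷ X) n + indicator (count n (x ∷ X))
  ≤⟨ +-mono-≤ (occupied-∷ x X n)
       (≤-trans (≤-reflexive (cong indicator (count-∷ n x X))) (indicator-+ (count n (x ∷ [])) (count n X))) ⟩
    (occupied (x ∷ []) n + occupied X n) + (indicator (count n (x ∷ [])) + indicator (count n X))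
  ≡⟨ solve 4 (λ a b e f → (a :+ b) :+ (e :+ f) := (a :+ e) :+ (b :+ f)) refl
       (occupied (x ∷ []) n) (occupied X n) (indicator (count n (x ∷ []))) (indicator (count n X)) ⟩
    (occupied (x ∷ []) n + indicator (count n (x ∷ []))) + (occupied X n + indicator (count n X))
  ∎
  where open ≤-Reasoning

occupied≤length : ∀ X n → occupied X n ≤ length X
occupied≤length []      zero    = z≤n
occupied≤length []      (suc n) = ≤-trans (≤-reflexive (+-identityʳ (occupied [] n))) (occupied≤length [] n)
occupied≤length (x ∷ X) n       =
  ≤-trans (occupied-∷ x X n) (+-mono-≤ (occupied-singleton x n) (occupied≤length X n))

blocks-covered : ∀ s used X n → (∀ j → j < n → used j < s → 1 ≤ count j X) →
  n * s ≤ s * occupied X n + sumTo used n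
blocks-covered s used X zero    covered = z≤n
blocks-covered s used X (suc n) covered = begin
    s + n * s
  ≤⟨ +-mono-≤ last (blocks-covered s used X n (λ j lt → covered j (≤-trans lt (n≤1+n n)))) ⟩
    (s * indicator (count n X) + used n) + (s * occupied X n + sumTo used n)
  ≡⟨ solve 5 (λ S a b e f → (S :* a :+ b) :+ (S :* e :+ f) := S :* (e :+ a) :+ (f :+ b)) refl
       s (indicator (count n X)) (used n) (occupied X n) (sumTo used n) ⟩
    s * (occupied X n + indicator (count n X)) + (sumTo used n + used n)
  ∎
  where
  open ≤-Reasoning
  last : s ≤ s * indicator (count n X) + used n
  last with used n <? s
  ... | no ≮s = ≤-trans (≮⇒≥ ≮s) (m≤n+m (used n) _)
  ... | yes <s with count n X | covered n ≤-refl <s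
  ...   | suc _ | _ = ≤-trans (≤-reflexive (sym (*-identityʳ s))) (m≤m+n (s * 1) (used n))

blocks-not-covered : ∀ s k r used X .{{_ : NonZero s}} →
  (∀ j → j < k + suc (r / s) → used j < s → 1 ≤ count j X) →
  length X ≤ k → sumTo used (k + suc (r / s)) ≤ r → ⊥
blocks-not-covered s k r used X covered X≤k used≤r = <-irrefl refl (begin-strict
    k * s + suc (r / s) * s
  ≡⟨ sym (*-distribʳ-+ s k (suc (r / s))) ⟩
    (k + suc (r / s)) * s
  ≤⟨ blocks-covered s used X (k + suc (r / s)) covered ⟩
    s * occupied X (k + suc (r / s)) + sumTo used (k + suc (r / s))
  ≤⟨ +-mono-≤ (*-monoʳ-≤ s (≤-trans (occupied≤length X (k + suc (r / s))) X≤k)) used≤r ⟩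
    s * k + r
  <⟨ +-monoʳ-< (s * k) r< ⟩
    s * k + suc (r / s) * s
  ≡⟨ cong (_+ suc (r / s) * s) (*-comm s k) ⟩
    k * s + suc (r / s) * s
  ∎)
  where
  open ≤-Reasoning
  r< : r < suc (r / s) * s
  r< = begin-strict
      r
    ≡⟨ m≡m%n+[m/n]*n r s ⟩
      r % s + r / s * s
    <⟨ +-monoˡ-< (r / s * s) (m%n<n r s) ⟩
      s + r / s * s
    ∎

blockOffset< : ∀ n m j i → j < m → i < n → j * n + i < m * n
blockOffset< n m j i j<m i<n = begin-strict
    j * n + i   <⟨ +-monoʳ-< (j * n) i<n ⟩
    j * n + n   ≡⟨ +-comm (j * n) n ⟩
    suc j * n   ≤⟨ *-monoˡ-≤ n j<m ⟩
    m * n       ∎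
  where open ≤-Reasoning

blockOffset-injective : ∀ n j i j′ i′ → i < n → i′ < n → j * n + i ≡ j′ * n + i′ → j ≡ j′ × i ≡ i′
blockOffset-injective n zero    i zero     i′ lt lt′ e = refl , e
blockOffset-injective n zero    i (suc j′) i′ lt lt′ e =
  ⊥-elim (<⇒≱ lt (≤-trans (m≤m+n n (j′ * n)) (≤-trans (m≤m+n (n + j′ * n) i′) (≤-reflexive (sym e)))))
blockOffset-injective n (suc j) i zero     i′ lt lt′ e =
  ⊥-elim (<⇒≱ lt′ (≤-trans (m≤m+n n (j * n)) (≤-trans (m≤m+n (n + j * n) i) (≤-reflexive e))))
blockOffset-injective n (suc j) i (suc j′) i′ lt lt′ e
  with blockOffset-injective n j i j′ i′ lt lt′
         (+-cancelˡ-≡ n _ _ (trans (sym (+-assoc n (j * n) i)) (trans e (+-assoc n (j′ * n) i′))))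
... | refl , refl = refl , refl

data Outcome : Set where
  found    : Outcome
  extended : List (ℕ × ℕ) → (ℕ → ℕ) → Outcome
  stuck    : Outcome

-- Q is a path of colour c cut into M blocks of s = 2ℓ - 1 vertices; z is
-- a fresh vertex. The spider
-- of the other colour d is kept as the list E of its slots, in the order
-- they were attached, and used j counts the slots of block j in E, which
-- are always its first used j ones.
module Spiders (k L′ : ℕ) (c : Colour) (Q : List Vertex) (z M : ℕ) where
  ℓ : ℕ
  ℓ = suc L′

  s : ℕ
  s = suc L′ + L′

  d : Colour
  d = other c

  slot : ℕ × ℕ → Vertex
  slot (j , i) = nth 0 Q (j * s + i)

  data FreeBlock (used : ℕ → ℕ) (X : List ℕ) (n : ℕ) : Set where
    free     : ∀ j → j < n → used j < s → count j X ≡ 0 → FreeBlock used X n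
    noneFree : (∀ j → j < n → used j < s → 1 ≤ count j X) → FreeBlock used X n

  freeBlock? : ∀ used X n → FreeBlock used X n
  freeBlock? used X zero = noneFree (λ j ())
  freeBlock? used X (suc n) with freeBlock? used X n
  ... | free j lt <s ∉X = free j (≤-trans lt (n≤1+n n)) <s ∉X
  ... | noneFree covered with used n <? s | count n X ≟ 0
  ...   | yes <s | yes ∉X = free n ≤-refl <s ∉X
  ...   | yes <s | no ∈X  = noneFree covered′
    where
    covered′ : ∀ j → j < suc n → used j < s → 1 ≤ count j X
    covered′ j lt uj with j ≟ n
    ... | yes refl = n≢0⇒n>0 ∈X
    ... | no j≢n   = covered j (≤∧≢⇒< (≤-pred lt) j≢n) uj
  ...   | no ≮s  | _      = noneFree covered′
    where
    covered′ : ∀ j → j < suc n → used j < s → 1 ≤ count j X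
    covered′ j lt uj with j ≟ n
    ... | yes refl = ⊥-elim (≮s uj)
    ... | no j≢n   = covered j (≤∧≢⇒< (≤-pred lt) j≢n) uj

  -- The blocks a centre may not probe: its own block X₀ and the blocks
  -- where it already has a c-edge.
  excluded : List ℕ → List (ℕ × ℕ) → List ℕ
  excluded X₀ C = X₀ ++ map proj₁ C

  block-∉X₀ : ∀ X₀ C t → Distinct (excluded X₀ C) → t < length C → count (proj₁ (nth (0 , 0) C t)) X₀ ≡ 0
  block-∉X₀ X₀ C t distinct t< = Distinct-++⇒∉ X₀ (map proj₁ C) _ distinct
    (subst (λ y → 1 ≤ count y (map proj₁ C)) (nth-map proj₁ (0 , 0) C t)
      (nth-∈ 0 (map proj₁ C) t (subst (t <_) (sym (length-map proj₁ C)) t<)))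

  block-injective : ∀ X₀ C t t′ → Distinct (excluded X₀ C) → t < length C → t′ < length C →
    proj₁ (nth (0 , 0) C t) ≡ proj₁ (nth (0 , 0) C t′) → t ≡ t′
  block-injective X₀ C t t′ distinct t< t′< same =
    nth-injective 0 (map proj₁ C) (Distinct-++ʳ X₀ (map proj₁ C) distinct) t t′
      (subst (t <_) (sym (length-map proj₁ C)) t<) (subst (t′ <_) (sym (length-map proj₁ C)) t′<)
      (trans (nth-map proj₁ (0 , 0) C t) (trans same (sym (nth-map proj₁ (0 , 0) C t′))))

  -- The centre uv probes the next unused slot of a free block until it has
  -- k c-edges (a c-spider) or `need` new d-edges, which are attached to E.
  mutual
    probe : ℕ → Vertex → List ℕ → ℕ → List (ℕ × ℕ) → List (ℕ × ℕ) → (ℕ → ℕ) → Prog Outcome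
    probe zero       uv X₀ need C E used = ret stuck
    probe (suc fuel) uv X₀ need C E used with freeBlock? used (excluded X₀ C) M
    ... | noneFree _ = ret stuck
    ... | free j _ _ _ = ask uv (slot (j , used j)) (answer fuel uv X₀ need C E used j)

    answer : ℕ → Vertex → List ℕ → ℕ → List (ℕ × ℕ) → List (ℕ × ℕ) → (ℕ → ℕ) → ℕ → Colour → Prog Outcome
    answer fuel uv X₀ need C E used j col with col ≟ᶜ c
    ... | yes _ with suc (length C) ≟ k
    ...   | yes _ = ret found
    ...   | no _  = probe fuel uv X₀ need ((j , used j) ∷ C) E used
    answer fuel uv X₀ zero          C E used j col | no _ = ret (extended E used)
    answer fuel uv X₀ (suc zero)    C E used j col | no _ = ret (extended (E ∷ʳ (j , used j)) (bump used j))
    answer fuel uv X₀ (suc (suc n)) C E used j col | no _ =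
      probe fuel uv X₀ (suc n) C (E ∷ʳ (j , used j)) (bump used j)

  -- The t-th slot of E hangs from z when t < k, and from the (t - k)-th
  -- slot otherwise: E lists the d-spider level by level, leg by leg.
  parent : List (ℕ × ℕ) → ℕ → Vertex
  parent E t with t <? k
  ... | yes _ = z
  ... | no _  = slot (nth (0 , 0) E (t ∸ k))

  mutual
    layers : ℕ → List (ℕ × ℕ) → (ℕ → ℕ) → Prog ⊤
    layers zero    E used = ret tt
    layers (suc n) E used =
      probe (suc k) (slot (nth (0 , 0) E (length E ∸ k))) (proj₁ (nth (0 , 0) E (length E ∸ k)) ∷ [])
        1 [] E used >>= nextLayer n

    nextLayer : ℕ → Outcome → Prog ⊤
    nextLayer n found             = ret tt
    nextLayer n (extended E used) = layers n E used
    nextLayer n stuck             = ret tt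

  firstLayer : Outcome → Prog ⊤
  firstLayer found             = ret tt
  firstLayer (extended E used) = layers (k * ℓ ∸ k) E used
  firstLayer stuck             = ret tt

  spiderProg : Prog ⊤
  spiderProg = probe (k + k) z [] k [] [] (λ _ → 0) >>= firstLayer

  -- The leg through the slot i of a block: upwards from i when i < ℓ, else
  -- downwards; either way it stays inside the block.
  leg : ℕ → ℕ → ℕ
  leg i p with i <? ℓ
  ... | yes _ = i + p
  ... | no _  = i ∸ p

  parent-< : ∀ E t → t < k → parent E t ≡ z
  parent-< E t lt with t <? k
  ... | yes _ = refl
  ... | no ≮k = ⊥-elim (≮k lt)

  parent-≥ : ∀ E t → k ≤ t → parent E t ≡ slot (nth (0 , 0) E (t ∸ k))
  parent-≥ E t le with t <? k
  ... | yes lt = ⊥-elim (<⇒≱ lt le)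
  ... | no _   = refl

  parent-+k : ∀ E t → parent E (k + t) ≡ slot (nth (0 , 0) E t)
  parent-+k E t = trans (parent-≥ E (k + t) (m≤m+n k t)) (cong (λ t′ → slot (nth (0 , 0) E t′)) (m+n∸m≡n k t))

  parent-++ : ∀ E X t → t < length E → parent (E ++ X) t ≡ parent E t
  parent-++ E X t lt with t <? k
  ... | yes _ = refl
  ... | no _  = cong slot (nth-++ˡ (0 , 0) E X (t ∸ k) (≤-<-trans (m∸n≤m t k) lt))

  leg-zero : ∀ i → leg i 0 ≡ i
  leg-zero i with i <? ℓ
  ... | yes _ = +-identityʳ i
  ... | no _  = refl

  leg<s : ∀ i p → i < s → p < ℓ → leg i p < s
  leg<s i p i<s p<ℓ with i <? ℓ
  ... | yes i<ℓ = s≤s (+-mono-≤ (≤-pred i<ℓ) (≤-pred p<ℓ))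
  ... | no _    = ≤-<-trans (m∸n≤m i p) i<s

  leg-injective : ∀ i p p′ → p < ℓ → p′ < ℓ → leg i p ≡ leg i p′ → p ≡ p′
  leg-injective i p p′ p<ℓ p′<ℓ e with i <? ℓ
  ... | yes _  = +-cancelˡ-≡ i p p′ e
  ... | no ≮ℓ = ∸-cancelˡ-≡ (≤-trans (<⇒≤ p<ℓ) (≮⇒≥ ≮ℓ)) (≤-trans (<⇒≤ p′<ℓ) (≮⇒≥ ≮ℓ)) e

  ∸≡suc∸suc : ∀ i p → suc p ≤ i → i ∸ p ≡ suc (i ∸ suc p)
  ∸≡suc∸suc (suc i) zero    le       = refl
  ∸≡suc∸suc (suc i) (suc p) (s≤s le) = ∸≡suc∸suc i p le

  module Correct (K₀ : History) (Q-long : M * s ≤ length Q) (Q-distinct : Distinct Q)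
                 (Q<z : ∀ x → 1 ≤ count x Q → x < z) (Q-path : Path K₀ c Q)
                 (k≥1 : 1 ≤ k) (M≡ : M ≡ k + suc ((k * ℓ ∸ 1) / s)) where

    slot-injective : ∀ j i j′ i′ → j < M → i < s → j′ < M → i′ < s →
      slot (j , i) ≡ slot (j′ , i′) → j ≡ j′ × i ≡ i′
    slot-injective j i j′ i′ j<M i<s j′<M i′<s e =
      blockOffset-injective s j i j′ i′ i<s i′<s
        (nth-injective 0 Q Q-distinct _ _ (≤-trans (blockOffset< s M j i j<M i<s) Q-long)
          (≤-trans (blockOffset< s M j′ i′ j′<M i′<s) Q-long) e)

    slot<z : ∀ j i → j < M → i < s → slot (j , i) < z
    slot<z j i j<M i<s = Q<z _ (nth-∈ 0 Q _ (≤-trans (blockOffset< s M j i j<M i<s) Q-long))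

    Q-edge : ∀ {K} → K₀ ⊆ K → ∀ i → suc i < M * s → EdgeIn K (nth 0 Q i) (nth 0 Q (suc i)) c
    Q-edge K₀⊆K i lt = EdgeIn-⊆ K₀⊆K (Path-nth Q i Q-path (≤-trans lt Q-long))

    leg-edge : ∀ {K} → K₀ ⊆ K → ∀ j i p → j < M → i < s → suc p < ℓ →
      EdgeIn K (slot (j , leg i p)) (slot (j , leg i (suc p))) c
    leg-edge {K} K₀⊆K j i p j<M i<s p<ℓ with i <? ℓ
    ... | yes i<ℓ = subst (λ y → EdgeIn K (nth 0 Q (j * s + (i + p))) (nth 0 Q y) c) (sym next)
                      (Q-edge K₀⊆K (j * s + (i + p)) (subst (_< M * s) next (blockOffset< s M j (i + suc p) j<M bound)))
      where
      next : j * s + (i + suc p) ≡ suc (j * s + (i + p))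
      next = trans (cong (j * s +_) (+-suc i p)) (+-suc (j * s) (i + p))
      bound : i + suc p < s
      bound = s≤s (+-mono-≤ (≤-pred i<ℓ) (≤-pred p<ℓ))
    ... | no ≮ℓ = subst (λ y → EdgeIn K (nth 0 Q y) (nth 0 Q (j * s + (i ∸ suc p))) c) (sym next)
                    (EdgeIn-sym (Q-edge K₀⊆K (j * s + (i ∸ suc p))
                      (subst (_< M * s) next (blockOffset< s M j (i ∸ p) j<M (≤-<-trans (m∸n≤m i p) i<s)))))
      where
      next : j * s + (i ∸ p) ≡ suc (j * s + (i ∸ suc p))
      next = trans (cong (j * s +_) (∸≡suc∸suc i p (≤-trans (<⇒≤ p<ℓ) (≮⇒≥ ≮ℓ)))) (+-suc (j * s) (i ∸ suc p))

    record Layers (K : History) (E : List (ℕ × ℕ)) (used : ℕ → ℕ) : Set where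
      field
        base     : K₀ ⊆ K
        used≤s   : ∀ j → used j ≤ s
        used-sum : sumTo used M ≡ length E
        inBlock  : ∀ q → 1 ≤ Countᵖ.count q E → proj₁ q < M × proj₂ q < used (proj₁ q)
        distinct : Countᵖ.Distinct E
        attached : ∀ t → t < length E → EdgeIn K (parent E t) (slot (nth (0 , 0) E t)) d

    Layers-⊆ : ∀ {K K′ E used} → K ⊆ K′ → Layers K E used → Layers K′ E used
    Layers-⊆ K⊆K′ L = record
      { base     = λ m → K⊆K′ (base m)
      ; used≤s   = used≤s
      ; used-sum = used-sum
      ; inBlock  = inBlock
      ; distinct = distinct
      ; attached = λ t lt → EdgeIn-⊆ K⊆K′ (attached t lt) }
      where open Layers L

    Layers-slot : ∀ {K E used} → Layers K E used → ∀ t → t < length E →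
      proj₁ (nth (0 , 0) E t) < M × proj₂ (nth (0 , 0) E t) < s
    Layers-slot {E = E} L t lt with Layers.inBlock L (nth (0 , 0) E t) (Countᵖ.nth-∈ (0 , 0) E t lt)
    ... | j<M , i<used = j<M , ≤-trans i<used (Layers.used≤s L _)

    Layers-slot-injective : ∀ {K E used} → Layers K E used → ∀ t t′ → t < length E → t′ < length E →
      slot (nth (0 , 0) E t) ≡ slot (nth (0 , 0) E t′) → t ≡ t′
    Layers-slot-injective {E = E} L t t′ t< t′< e
      with Layers-slot L t t< | Layers-slot L t′ t′<
    ... | j<M , i<s | j′<M , i′<s with slot-injective _ _ _ _ j<M i<s j′<M i′<s e
    ...   | same-block , same-offset =
      Countᵖ.nth-injective (0 , 0) E (Layers.distinct L) t t′ t< t′< (cong₂ _,_ same-block same-offset)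

    Layers-∷ʳ : ∀ {K E used} j → Layers K E used → j < M → used j < s →
      EdgeIn K (parent (E ∷ʳ (j , used j)) (length E)) (slot (j , used j)) d →
      Layers K (E ∷ʳ (j , used j)) (bump used j)
    Layers-∷ʳ {K} {E} {used} j L j<M uj<s new = record
      { base     = base
      ; used≤s   = used≤s′
      ; used-sum = trans (sumTo-bump used j M j<M) (trans (cong suc used-sum) (sym (length-∷ʳ E q)))
      ; inBlock  = inBlock′
      ; distinct = Countᵖ.Distinct-∷ʳ E q distinct q∉E
      ; attached = attached′ }
      where
      open Layers L
      q = (j , used j)
      used≤s′ : ∀ j′ → bump used j j′ ≤ s
      used≤s′ j′ with j′ ≟ j
      ... | yes refl = uj<s
      ... | no _     = used≤s j′
      q∉E : Countᵖ.count q E ≡ 0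
      q∉E with Countᵖ.count q E in e
      ... | zero  = refl
      ... | suc _ = ⊥-elim (1+n≰n (proj₂ (inBlock q (≤-trans (s≤s z≤n) (≤-reflexive (sym e))))))
      inBlock′ : ∀ q′ → 1 ≤ Countᵖ.count q′ (E ∷ʳ q) → proj₁ q′ < M × proj₂ q′ < bump used j (proj₁ q′)
      inBlock′ q′ le with ≡-dec _≟_ _≟_ q′ q
      ... | yes refl = j<M , ≤-reflexive (sym (bump-≡ used j))
      ... | no q′≢q with inBlock q′ (≤-trans le (≤-reflexive (Countᵖ.count-∷ʳ-≢ q′ E q q′≢q)))
      ...   | j′<M , i′< = j′<M , ≤-trans i′< (bump-≥ used j (proj₁ q′))
      attached′ : ∀ t → t < length (E ∷ʳ q) → EdgeIn K (parent (E ∷ʳ q) t) (slot (nth (0 , 0) (E ∷ʳ q) t)) d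
      attached′ t lt with t ≟ length E
      ... | yes refl rewrite nth-∷ʳ (0 , 0) E q = new
      ... | no t≢ = old (≤∧≢⇒< (≤-pred (≤-trans lt (≤-reflexive (length-∷ʳ E q)))) t≢)
        where
        old : t < length E → EdgeIn K (parent (E ∷ʳ q) t) (slot (nth (0 , 0) (E ∷ʳ q) t)) d
        old t< rewrite parent-++ E (q ∷ []) t t< | nth-++ˡ (0 , 0) E (q ∷ []) t t< = attached t t<

    Legs : History → Vertex → List (ℕ × ℕ) → Set
    Legs K uv C = ∀ q → 1 ≤ Countᵖ.count q C → EdgeIn K uv (slot q) c × proj₁ q < M × proj₂ q < s

    Apart : Vertex → List ℕ → Set
    Apart uv X₀ = ∀ j i → j < M → i < s → count j X₀ ≡ 0 → uv ≢ slot (j , i)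

    -- k c-edges from uv into distinct blocks other than uv's own: the legs
    -- run along Q inside these blocks.
    c-spider : ∀ {K} uv X₀ C → K₀ ⊆ K → length C ≡ k → Legs K uv C → Distinct (excluded X₀ C) →
      Apart uv X₀ → MonoCopy (spider k ℓ) K
    c-spider {K} uv X₀ C K₀⊆K |C|≡k legs distinct apart = c , f , f-injective , edges
      where
      start : Fin k → ℕ × ℕ
      start a = nth (0 , 0) C (toℕ a)
      a<|C| : ∀ (a : Fin k) → toℕ a < length C
      a<|C| a = subst (toℕ a <_) (sym |C|≡k) (toℕ<n a)
      start-leg : ∀ a → EdgeIn K uv (slot (start a)) c × proj₁ (start a) < M × proj₂ (start a) < s
      start-leg a = legs (start a) (Countᵖ.nth-∈ (0 , 0) C (toℕ a) (a<|C| a))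
      block<M : ∀ a → proj₁ (start a) < M
      block<M a = proj₁ (proj₂ (start-leg a))
      block∉X₀ : ∀ a → count (proj₁ (start a)) X₀ ≡ 0
      block∉X₀ a = block-∉X₀ X₀ C (toℕ a) distinct (a<|C| a)
      f : Maybe (Fin k × Fin ℓ) → Vertex
      f nothing        = uv
      f (just (a , p)) = slot (proj₁ (start a) , leg (proj₂ (start a)) (toℕ p))
      leg<s′ : ∀ a (p : Fin ℓ) → leg (proj₂ (start a)) (toℕ p) < s
      leg<s′ a p = leg<s _ _ (proj₂ (proj₂ (start-leg a))) (toℕ<n p)
      f-injective : Injective _≡_ _≡_ f
      f-injective {nothing}       {nothing}        e = refl
      f-injective {nothing}       {just (a , p)}   e = ⊥-elim (apart _ _ (block<M a) (leg<s′ a p) (block∉X₀ a) e)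
      f-injective {just (a , p)}  {nothing}        e = ⊥-elim (apart _ _ (block<M a) (leg<s′ a p) (block∉X₀ a) (sym e))
      f-injective {just (a , p)}  {just (a′ , p′)} e
        with slot-injective _ _ _ _ (block<M a) (leg<s′ a p) (block<M a′) (leg<s′ a′ p′) e
      ... | same-block , same-offset
        with toℕ-injective (block-injective X₀ C (toℕ a) (toℕ a′) distinct (a<|C| a) (a<|C| a′) same-block)
      ...   | refl with toℕ-injective (leg-injective (proj₂ (start a)) _ _ (toℕ<n p) (toℕ<n p′) same-offset)
      ...     | refl = refl
      edges : ∀ x y → SpiderAdj k ℓ x y → EdgeIn K (f x) (f y) c
      edges .nothing .(just (a , p)) (centre a p p≡0) =
        subst (λ o → EdgeIn K uv (slot (proj₁ (start a) , o)) c)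
          (sym (trans (cong (leg (proj₂ (start a))) p≡0) (leg-zero _))) (proj₁ (start-leg a))
      edges .(just (a , p)) .(just (a , q)) (step a p q q≡p+1) =
        subst (λ t → EdgeIn K (f (just (a , p))) (slot (proj₁ (start a) , leg (proj₂ (start a)) t)) c)
          (sym q≡p+1)
          (leg-edge K₀⊆K (proj₁ (start a)) (proj₂ (start a)) (toℕ p) (block<M a) (proj₂ (proj₂ (start-leg a)))
            (subst (_< ℓ) q≡p+1 (toℕ<n q)))

    -- Leg a of the d-spider is E[a], E[a + k], E[a + 2k], ...
    d-spider : ∀ {K E used} → Layers K E used → length E ≡ k * ℓ → MonoCopy (spider k ℓ) K
    d-spider {K} {E} L |E|≡kℓ = d , f , f-injective , edges
      where
      open Layers L
      index : Fin k → Fin ℓ → ℕ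
      index a p = toℕ p * k + toℕ a
      index< : ∀ a p → index a p < length E
      index< a p = subst (index a p <_) (trans (*-comm ℓ k) (sym |E|≡kℓ))
                     (blockOffset< k ℓ (toℕ p) (toℕ a) (toℕ<n p) (toℕ<n a))
      at : Fin k → Fin ℓ → ℕ × ℕ
      at a p = nth (0 , 0) E (index a p)
      f : Maybe (Fin k × Fin ℓ) → Vertex
      f nothing        = z
      f (just (a , p)) = slot (at a p)
      f≢z : ∀ a p → slot (at a p) ≢ z
      f≢z a p e with Layers-slot L (index a p) (index< a p)
      ... | j<M , i<s = <-irrefl e (slot<z _ _ j<M i<s)
      f-injective : Injective _≡_ _≡_ f
      f-injective {nothing}      {nothing}        e = refl
      f-injective {nothing}      {just (a , p)}   e = ⊥-elim (f≢z a p (sym e))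
      f-injective {just (a , p)} {nothing}        e = ⊥-elim (f≢z a p e)
      f-injective {just (a , p)} {just (a′ , p′)} e
        with blockOffset-injective k (toℕ p) (toℕ a) (toℕ p′) (toℕ a′) (toℕ<n a) (toℕ<n a′)
               (Layers-slot-injective L (index a p) (index a′ p′) (index< a p) (index< a′ p′) e)
      ... | p≡p′ , a≡a′ with toℕ-injective p≡p′ | toℕ-injective a≡a′
      ...   | refl | refl = refl
      edges : ∀ x y → SpiderAdj k ℓ x y → EdgeIn K (f x) (f y) d
      edges .nothing .(just (a , p)) (centre a p p≡0) =
        subst (λ t → EdgeIn K z (slot (nth (0 , 0) E t)) d) (sym (cong (λ m → m * k + toℕ a) p≡0))
          (subst (λ u → EdgeIn K u (slot (nth (0 , 0) E (toℕ a))) d) (parent-< E (toℕ a) (toℕ<n a))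
            (attached (toℕ a) (subst (λ m → m * k + toℕ a < length E) p≡0 (index< a p))))
      edges .(just (a , p)) .(just (a , q)) (step a p q q≡p+1) =
        subst (λ u → EdgeIn K u (slot (at a q)) d) (parent-+k E (index a p))
          (subst (λ t → EdgeIn K (parent E t) (slot (at a q)) d) index≡ (attached (index a q) (index< a q)))
        where
        index≡ : index a q ≡ k + index a p
        index≡ = trans (cong (λ m → m * k + toℕ a) q≡p+1) (+-assoc k (toℕ p * k) (toℕ a))

    record Probing (K : History) (uv : Vertex) (X₀ : List ℕ) (C : List (ℕ × ℕ)) : Set where
      field
        legs     : Legs K uv C
        distinct : Distinct (excluded X₀ C)
        apart    : Apart uv X₀
        ownBlock : length X₀ ≤ 1
        fewLegs  : length C < k

    Probing-⊆ : ∀ {K K′ uv X₀ C} → K ⊆ K′ → Probing K uv X₀ C → Probing K′ uv X₀ C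
    Probing-⊆ K⊆K′ P = record
      { legs     = λ q le → EdgeIn-⊆ K⊆K′ (proj₁ (legs q le)) , proj₂ (legs q le)
      ; distinct = distinct
      ; apart    = apart
      ; ownBlock = ownBlock
      ; fewLegs  = fewLegs }
      where open Probing P

    Legs-∷ : ∀ {K uv C} j i → Legs K uv C → j < M → i < s →
      Legs ((uv , slot (j , i) , c) ∷ K) uv ((j , i) ∷ C)
    Legs-∷ {K} {uv} {C} j i legs j<M i<s q le = by-cases (≡-dec _≟_ _≟_ q (j , i))
      where
      by-cases : Dec (q ≡ (j , i)) → EdgeIn ((uv , slot (j , i) , c) ∷ K) uv (slot q) c × proj₁ q < M × proj₂ q < s
      by-cases (yes refl) = inj₁ (here refl) , j<M , i<s
      by-cases (no q≢) with legs q (subst (1 ≤_) (trans (Countᵖ.count-∷ q (j , i) C)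
                                      (cong (_+ Countᵖ.count q C) (Countᵖ.count-≢ q (j , i) q≢))) le)
      ... | e , bounds = EdgeIn-⊆ there e , bounds

    Probing-∷ : ∀ {K uv X₀ C} j i → Probing K uv X₀ C → j < M → i < s → count j (excluded X₀ C) ≡ 0 →
      suc (suc (length C)) ≤ k → Probing ((uv , slot (j , i) , c) ∷ K) uv X₀ ((j , i) ∷ C)
    Probing-∷ {X₀ = X₀} {C} j i P j<M i<s j∉X |C|+2≤k = record
      { legs     = Legs-∷ j i legs j<M i<s
      ; distinct = Distinct-insert X₀ (map proj₁ C) j distinct j∉X
      ; apart    = apart
      ; ownBlock = ownBlock
      ; fewLegs  = |C|+2≤k }
      where open Probing P

    Achieved : List (ℕ × ℕ) → ℕ → History → Outcome → Set
    Achieved E need K found               = MonoCopy (spider k ℓ) K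
    Achieved E need K (extended E′ used′) = Layers K E′ used′ × length E′ ≡ length E + need
    Achieved E need K stuck               = ⊥

    ParentOfNext : List (ℕ × ℕ) → Vertex → ℕ → Set
    ParentOfNext E uv need = ∀ E′ → (∀ i → i < length E → nth (0 , 0) E′ i ≡ nth (0 , 0) E i) →
      ∀ t → length E ≤ t → t < length E + need → parent E′ t ≡ uv

    ParentOfNext-∷ʳ : ∀ {E uv n} q → ParentOfNext E uv (suc (suc n)) → ParentOfNext (E ∷ʳ q) uv (suc n)
    ParentOfNext-∷ʳ {E} {uv} {n} q next E′ agree t le lt =
      next E′ (λ i i< → trans (agree i (≤-trans i< (≤-trans (n≤1+n _) (≤-reflexive (sym |E′|)))))
                              (nth-++ˡ (0 , 0) E _ i i<))
        t (≤-trans (n≤1+n _) (≤-trans (≤-reflexive (sym |E′|)) le))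
        (≤-trans lt (≤-reflexive (trans (cong (_+ suc n) |E′|) (sym (+-suc (length E) (suc n))))))
      where
      |E′| : length (E ∷ʳ q) ≡ suc (length E)
      |E′| = length-∷ʳ E q

    attach : ∀ {K uv E n col} q → ParentOfNext E uv (suc n) → col ≢ c →
      EdgeIn ((uv , slot q , col) ∷ K) (parent (E ∷ʳ q) (length E)) (slot q) d
    attach {E = E} {col = col} q next col≢c
      rewrite next (E ∷ʳ q) (λ i lt → nth-++ˡ (0 , 0) E _ i lt) (length E) ≤-refl
                (≤-trans (≤-reflexive (+-comm 1 (length E))) (+-monoʳ-≤ (length E) (s≤s z≤n)))
            | ≢⇒other c col col≢c = inj₁ (here refl)

    mutual
      probe-ok : ∀ fuel uv X₀ n C E used K → suc n + (k ∸ suc (length C)) ≤ fuel →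
        length E + suc n ≤ k * ℓ → Layers K E used → Probing K uv X₀ C → ParentOfNext E uv (suc n) →
        Forces (probe fuel uv X₀ (suc n) C E used) (suc n + (k ∸ suc (length C))) K (Achieved E (suc n))
      probe-ok zero uv X₀ n C E used K () room L P next
      probe-ok (suc fuel) uv X₀ n C E used K budget room L P next with freeBlock? used (excluded X₀ C) M
      ... | noneFree covered =
        ⊥-elim (blocks-not-covered s k (k * ℓ ∸ 1) used (excluded X₀ C)
                  (subst (λ m → ∀ j → j < m → used j < s → 1 ≤ count j (excluded X₀ C)) M≡ covered)
                  |X|≤k (subst (λ m → sumTo used m ≤ k * ℓ ∸ 1) M≡ sum≤))
        where
        open Probing P
        |X|≤k : length (excluded X₀ C) ≤ k
        |X|≤k = ≤-trans (≤-reflexive (trans (length-++ X₀) (cong (length X₀ +_) (length-map proj₁ C))))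
                  (≤-trans (+-monoˡ-≤ (length C) ownBlock) fewLegs)
        sum≤ : sumTo used M ≤ k * ℓ ∸ 1
        sum≤ = subst (_≤ k * ℓ ∸ 1) (sym (Layers.used-sum L))
                 (<⇒≤pred (≤-trans (s≤s (m≤m+n (length E) n)) (≤-trans (≤-reflexive (sym (+-suc (length E) n))) room)))
      ... | free j j<M uj<s j∉X = uv≢ , λ col →
              answer-ok fuel uv X₀ n C E used K j col (≤-pred budget) room L P next j<M uj<s j∉X
        where
        uv≢ : uv ≢ slot (j , used j)
        uv≢ = Probing.apart P j (used j) j<M uj<s (m+n≡0⇒m≡0 (count j X₀) (trans (sym (count-++ j X₀ _)) j∉X))

      answer-ok : ∀ fuel uv X₀ n C E used K j col → n + (k ∸ suc (length C)) ≤ fuel →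
        length E + suc n ≤ k * ℓ → Layers K E used → Probing K uv X₀ C → ParentOfNext E uv (suc n) →
        j < M → used j < s → count j (excluded X₀ C) ≡ 0 →
        Forces (answer fuel uv X₀ (suc n) C E used j col) (n + (k ∸ suc (length C)))
           ((uv , slot (j , used j) , col) ∷ K) (Achieved E (suc n))
      answer-ok fuel uv X₀ n C E used K j col budget room L P next j<M uj<s j∉X with col ≟ᶜ c
      ... | yes refl with suc (length C) ≟ k
      ...   | yes |C|+1≡k =
        c-spider uv X₀ ((j , used j) ∷ C) (λ m → there (Layers.base L m)) |C|+1≡k
          (Legs-∷ j (used j) (Probing.legs P) j<M uj<s)
          (Distinct-insert X₀ (map proj₁ C) j (Probing.distinct P) j∉X) (Probing.apart P)
      ...   | no ≢k = Forces-≤ (probe fuel uv X₀ (suc n) ((j , used j) ∷ C) E used) (≤-reflexive budget≡)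
                (probe-ok fuel uv X₀ n ((j , used j) ∷ C) E used _ (≤-trans (≤-reflexive budget≡) budget) room
                  (Layers-⊆ there L) (Probing-∷ j (used j) P j<M uj<s j∉X |C|+2≤k) next)
        where
        |C|+2≤k : suc (suc (length C)) ≤ k
        |C|+2≤k = ≤∧≢⇒< (Probing.fewLegs P) ≢k
        budget≡ : suc n + (k ∸ suc (suc (length C))) ≡ n + (k ∸ suc (length C))
        budget≡ = trans (sym (+-suc n _)) (cong (n +_) (sym (∸≡suc∸suc k (suc (length C)) |C|+2≤k)))
      answer-ok fuel uv X₀ zero C E used K j col budget room L P next j<M uj<s j∉X | no col≢c =
        Layers-∷ʳ j (Layers-⊆ there L) j<M uj<s (attach (j , used j) next col≢c) ,
        trans (length-∷ʳ E (j , used j)) (+-comm 1 (length E))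
      answer-ok fuel uv X₀ (suc n) C E used K j col budget room L P next j<M uj<s j∉X | no col≢c =
        Forces-map (probe fuel uv X₀ (suc n) C (E ∷ʳ q) (bump used j)) longer
          (probe-ok fuel uv X₀ n C (E ∷ʳ q) (bump used j) _ budget room′
            (Layers-∷ʳ j (Layers-⊆ there L) j<M uj<s (attach q next col≢c)) (Probing-⊆ there P)
            (ParentOfNext-∷ʳ {E} q next))
        where
        q = (j , used j)
        |E′|+n : length (E ∷ʳ q) + suc n ≡ length E + suc (suc n)
        |E′|+n = trans (cong (_+ suc n) (length-∷ʳ E q)) (sym (+-suc (length E) (suc n)))
        room′ : length (E ∷ʳ q) + suc n ≤ k * ℓ
        room′ = subst (_≤ k * ℓ) (sym |E′|+n) room
        longer : ∀ K′ r → Achieved (E ∷ʳ q) (suc n) K′ r → Achieved E (suc (suc n)) K′ r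
        longer K′ found           copy          = copy
        longer K′ (extended _ _) (L′ , |E″|) = L′ , trans |E″| |E′|+n
        longer K′ stuck           ()

    mutual
      layers-ok : ∀ n E used K → Layers K E used → length E + n ≡ k * ℓ → k ≤ length E →
        Forces (layers n E used) (n * k) K (CopyOf (spider k ℓ))
      layers-ok zero E used K L full k≤|E| = d-spider L (trans (sym (+-identityʳ _)) full)
      layers-ok (suc n) E used K L full k≤|E| =
        Forces-≤ (probe (suc k) uv X₀ 1 [] E used >>= nextLayer n) (≤-reflexive (cong (_+ n * k) (m+[n∸m]≡n k≥1)))
          (Forces->>= (probe (suc k) uv X₀ 1 [] E used) {g = nextLayer n} {n = 1 + (k ∸ 1)} {m = n * k}
            (Forces-map (probe (suc k) uv X₀ 1 [] E used) {n = 1 + (k ∸ 1)} continue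
              (probe-ok (suc k) uv X₀ 0 [] E used K (s≤s (m∸n≤m k 1))
                (≤-trans (+-monoʳ-≤ (length E) (s≤s (z≤n {n}))) (≤-reflexive full)) L P next)))
        where
        t = length E ∸ k
        t<|E| : t < length E
        t<|E| = ∸-monoʳ-< k≥1 k≤|E|
        hub = nth (0 , 0) E t
        uv = slot hub
        X₀ = proj₁ hub ∷ []
        in-range = Layers-slot L t t<|E|
        P : Probing K uv X₀ []
        P = record
          { legs     = λ q ()
          ; distinct = λ x → count-singleton≤1 x (proj₁ hub)
          ; apart    = apart
          ; ownBlock = ≤-refl
          ; fewLegs  = k≥1 }
          where
          apart : Apart uv X₀
          apart j i j<M i<s j∉X₀ e with slot-injective _ _ _ _ (proj₁ in-range) (proj₂ in-range) j<M i<s e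
          ... | refl , _ = 0≢1+n (trans (sym j∉X₀) (count-self j))
        next : ParentOfNext E uv 1
        next E′ agree t′ le lt with ≤-antisym le (≤-pred (≤-trans lt (≤-reflexive (+-comm (length E) 1))))
        ... | refl = trans (parent-≥ E′ (length E) k≤|E|) (cong slot (agree t t<|E|))
        continue : ∀ K′ r → Achieved E 1 K′ r → Forces (nextLayer n r) (n * k) K′ (CopyOf (spider k ℓ))
        continue K′ found               copy          = copy
        continue K′ (extended E′ used′) (L′ , |E′|) = layers-ok n E′ used′ K′ L′
          (trans (cong (_+ n) |E′|) (trans (+-assoc (length E) 1 n) full))
          (≤-trans k≤|E| (≤-trans (n≤1+n _) (≤-reflexive (trans (+-comm 1 (length E)) (sym |E′|)))))
        continue K′ stuck               ()

    spiderProg-ok : Forces spiderProg ((k + (k ∸ 1)) + (k * ℓ ∸ k) * k) K₀ (CopyOf (spider k ℓ))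
    spiderProg-ok =
      Forces->>= (probe (k + k) z [] k [] [] (λ _ → 0)) {g = firstLayer} {n = k + (k ∸ 1)}
        (Forces-map (probe (k + k) z [] k [] [] (λ _ → 0)) {n = k + (k ∸ 1)} continue
          (subst (λ m → Forces (probe (k + k) z [] m [] [] (λ _ → 0)) (m + (k ∸ 1)) K₀ (Achieved [] m)) k≡
            (probe-ok (k + k) z [] (k ∸ 1) [] [] (λ _ → 0) K₀ budget room L₀ P₀ next₀)))
      where
      k≡ : suc (k ∸ 1) ≡ k
      k≡ = m+[n∸m]≡n k≥1
      budget : suc (k ∸ 1) + (k ∸ 1) ≤ k + k
      budget = subst (λ m → m + (k ∸ 1) ≤ k + k) (sym k≡) (+-monoʳ-≤ k (m∸n≤m k 1))
      room : suc (k ∸ 1) ≤ k * ℓ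
      room = subst (_≤ k * ℓ) (sym k≡) (m≤m*n k ℓ)
      L₀ : Layers K₀ [] (λ _ → 0)
      L₀ = record
        { base = λ m → m ; used≤s = λ _ → z≤n ; used-sum = sumTo-zero M
        ; inBlock = λ q () ; distinct = λ q → z≤n ; attached = λ t () }
      P₀ : Probing K₀ z [] []
      P₀ = record
        { legs = λ q () ; distinct = λ x → z≤n
        ; apart = λ j i j<M i<s _ e → <-irrefl (sym e) (slot<z j i j<M i<s)
        ; ownBlock = z≤n ; fewLegs = k≥1 }
      next₀ : ParentOfNext [] z (suc (k ∸ 1))
      next₀ E′ agree t le lt = parent-< E′ t (subst (t <_) k≡ lt)
      continue : ∀ K′ r → Achieved [] k K′ r → Forces (firstLayer r) ((k * ℓ ∸ k) * k) K′ (CopyOf (spider k ℓ))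
      continue K′ found              copy        = copy
      continue K′ (extended E used) (L , |E|) =
        layers-ok (k * ℓ ∸ k) E used K′ L (trans (cong (_+ (k * ℓ ∸ k)) |E|) (m+[n∸m]≡n (m≤m*n k ℓ)))
          (≤-reflexive (sym |E|))
      continue K′ stuck              ()

blockSize : ℕ → ℕ
blockSize L′ = suc L′ + L′

blocks : ℕ → ℕ → ℕ
blocks k L′ = k + suc ((k * suc L′ ∸ 1) / blockSize L′)

pathEdges : ℕ → ℕ → ℕ
pathEdges k L′ = blocks k L′ * blockSize L′ ∸ 1

rounds : ℕ → ℕ → ℕ
rounds k L′ = 2 * (pathEdges k L′ + (pathEdges k L′ ∸ 1)) + ((k + (k ∸ 1)) + (k * suc L′ ∸ k) * k)

longer : ℕ → PathPair → Colour
longer N P with N ≤? length (proj₁ P)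
... | yes _ = red
... | no _  = blue

longer-long : ∀ N P → size P ≡ N + (N ∸ 1) → N ≤ length (pathOf (longer N P) P)
longer-long N P |P| with N ≤? length (proj₁ P)
... | yes N≤ = N≤
... | no N≰  = +-cancelˡ-≤ (N ∸ 1) N (length (proj₂ P)) (begin
    N ∸ 1 + N                         ≡⟨ trans (+-comm (N ∸ 1) N) (sym |P|) ⟩
    length (proj₁ P) + length (proj₂ P) ≤⟨ +-monoˡ-≤ (length (proj₂ P)) (<⇒≤pred (≰⇒> N≰)) ⟩
    N ∸ 1 + length (proj₂ P)          ∎)
  where open ≤-Reasoning

module Strategy (k L′ : ℕ) (k≥1 : 1 ≤ k) where
  ℓ = suc L′
  N = pathEdges k L′

  spiderFrom : VConfig → Prog ⊤
  spiderFrom (F , v , P) = Spiders.spiderProg k L′ (longer N P) (v ∷ pathOf (longer N P) P) F (blocks k L′)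

  strategy : Prog ⊤
  strategy = growTimes (N + (N ∸ 1)) (1 , 0 , ([] , [])) >>= spiderFrom

  start-valid : ValidV [] (1 , 0 , ([] , []))
  start-valid = (λ x → ≤-trans (≤-reflexive (+-identityʳ _)) (count-singleton≤1 x 0)) , below , paths
    where
    below : ∀ x → 1 ≤ multiplicity 0 ([] , []) x → x < 1
    below x le with count-singleton-pos x 0 (≤-trans le (≤-reflexive (+-identityʳ _)))
    ... | refl = s≤s z≤n
    paths : (a : Colour) → Path [] a (0 ∷ pathOf a ([] , []))
    paths red  = tt
    paths blue = tt

  spiderFrom-ok : ∀ K V → ValidV K V × sizeV V ≡ (N + (N ∸ 1)) + 0 →
    Forces (spiderFrom V) ((k + (k ∸ 1)) + (k * ℓ ∸ k) * k) K (CopyOf (spider k ℓ))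
  spiderFrom-ok K (F , v , P) ((mult≤1 , mult<F , paths) , |P|) =
    Spiders.Correct.spiderProg-ok k L′ c (v ∷ pathOf c P) F (blocks k L′) K long distinct below (paths c) k≥1 refl
    where
    c = longer N P
    long : blocks k L′ * blockSize L′ ≤ length (v ∷ pathOf c P)
    long = ≤-trans (m≤n+m∸n _ 1) (s≤s (longer-long N P (trans |P| (+-identityʳ _))))
    count≤multiplicity : ∀ x → count x (v ∷ pathOf c P) ≤ multiplicity v P x
    count≤multiplicity x rewrite count-∷ x v (pathOf c P) | count-pathOf c P x =
      +-monoʳ-≤ (count x (v ∷ [])) (m≤m+n (count x (pathOf c P)) _)
    distinct : Distinct (v ∷ pathOf c P)
    distinct x = ≤-trans (count≤multiplicity x) (mult≤1 x)
    below : ∀ x → 1 ≤ count x (v ∷ pathOf c P) → x < F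
    below x le = mult<F x (≤-trans le (count≤multiplicity x))

  strategy-ok : Forces strategy (rounds k L′) [] (CopyOf (spider k ℓ))
  strategy-ok =
    Forces->>= (growTimes (N + (N ∸ 1)) (1 , 0 , ([] , []))) {g = spiderFrom}
      (Forces-map (growTimes (N + (N ∸ 1)) (1 , 0 , ([] , []))) spiderFrom-ok
        (growTimes-ok (N + (N ∸ 1)) [] (1 , 0 , ([] , [])) start-valid))

blocks*blockSize≤ : ∀ k L′ → blocks k L′ * blockSize L′ ≤ (k + 1) * blockSize L′ + (k * suc L′ ∸ 1)
blocks*blockSize≤ k L′ = begin
    (k + suc q) * s       ≡⟨ solve 3 (λ k q s → (k :+ (con 1 :+ q)) :* s := (k :+ con 1) :* s :+ q :* s) refl k q s ⟩
    (k + 1) * s + q * s   ≤⟨ +-monoʳ-≤ ((k + 1) * s) (m/n*n≤m r s) ⟩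
    (k + 1) * s + r       ∎
  where
  open ≤-Reasoning
  s = blockSize L′
  r = k * suc L′ ∸ 1
  q = r / s

-- Growing a path with m - 1 edges takes 2 (2m - 3) = 4m - 6 rounds.
path-cost : ∀ m → 2 ≤ m → 2 * ((m ∸ 1) + (m ∸ 1 ∸ 1)) + 6 ≡ 4 * m
path-cost (suc (suc y)) _        = solve 1 (λ y → con 2 :* ((con 1 :+ y) :+ y) :+ con 6 := con 4 :* (con 2 :+ y)) refl y
path-cost (suc zero)    (s≤s ())

rounds≤ : ∀ a b → rounds (3 + a) (1 + b) ≤ (3 + a) * (3 + a) * (2 + b) + 15 * (3 + a) * (2 + b) + 2 * (3 + a) ∸ 12
rounds≤ a b = m+n≤o⇒m≤o∸n (rounds k L′) (begin
    rounds k L′ + 12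
  ≡⟨ solve 2 (λ A B → (A :+ B) :+ con 12 := ((A :+ con 6) :+ B) :+ con 6) refl (2 * (N + (N ∸ 1))) spiders ⟩
    (2 * (N + (N ∸ 1)) + 6) + spiders + 6
  ≡⟨ cong (λ x → x + spiders + 6) (path-cost (blocks k L′ * s) (s≤s (s≤s z≤n))) ⟩
    4 * (blocks k L′ * s) + spiders + 6
  ≤⟨ +-monoˡ-≤ 6 (+-mono-≤ (*-monoʳ-≤ 4 (blocks*blockSize≤ k L′)) spiders≤) ⟩
    4 * ((k + 1) * s + (k * ℓ ∸ 1)) + (k + k + k * ℓ * k) + 6
  ≤⟨ +-monoˡ-≤ 6 (+-monoˡ-≤ (k + k + k * ℓ * k) (*-monoʳ-≤ 4 (+-monoʳ-≤ ((k + 1) * s) (m∸n≤m (k * ℓ) 1)))) ⟩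
    4 * ((k + 1) * s + k * ℓ) + (k + k + k * ℓ * k) + 6
  ≤⟨ m≤m+n _ (12 + 10 * a + b + 3 * a * b) ⟩
    4 * ((k + 1) * s + k * ℓ) + (k + k + k * ℓ * k) + 6 + (12 + 10 * a + b + 3 * a * b)
  ≡⟨ solve 2 (λ a b →
       let k = con 3 :+ a ; ℓ = con 2 :+ b ; s = (con 2 :+ b) :+ (con 1 :+ b) in
       con 4 :* ((k :+ con 1) :* s :+ k :* ℓ) :+ (k :+ k :+ k :* ℓ :* k) :+ con 6
         :+ (con 12 :+ con 10 :* a :+ b :+ con 3 :* a :* b)
       := k :* k :* ℓ :+ con 15 :* k :* ℓ :+ con 2 :* k) refl a b ⟩
    k * k * ℓ + 15 * k * ℓ + 2 * k
  ∎)
  where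
  open ≤-Reasoning
  k = 3 + a
  L′ = 1 + b
  ℓ = 2 + b
  s = blockSize L′
  N = pathEdges k L′
  spiders = (k + (k ∸ 1)) + (k * ℓ ∸ k) * k
  spiders≤ : spiders ≤ k + k + k * ℓ * k
  spiders≤ = +-mono-≤ (+-monoʳ-≤ k (m∸n≤m k 1)) (*-monoˡ-≤ k (m∸n≤m (k * ℓ) k))

theorem6 : (k ℓ : ℕ) → 3 ≤ k → 2 ≤ ℓ →
    OnlineRamseyAtMost (spider k ℓ) (k * k * ℓ + 15 * k * ℓ + 2 * k ∸ 12)
theorem6 (suc (suc (suc a))) (suc (suc b)) _ _ =
  Forces⇒OnlineRamseyAtMost strategy (Forces-≤ strategy (rounds≤ a b) strategy-ok)
  where open Strategy (3 + a) (1 + b) (s≤s z≤n)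
theorem6 zero                 _              ()                   _
theorem6 (suc zero)           _              (s≤s ())             _
theorem6 (suc (suc zero))     _              (s≤s (s≤s ()))       _
theorem6 (suc (suc (suc a)))  zero           _                    ()
theorem6 (suc (suc (suc a)))  (suc zero)     _                    (s≤s ())
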